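{- Let $\Gamma=(U\cup V,E)$ be a $3$-regular bipartite graph with bipartition $U,V$, let $m=|U|$, let $\hat\Gamma$ be its CFI graph with sides $X,Y$ and $n=|X|=|Y|=10m$, fix bijections $\eta:X\to[n]$, $\eta':Y\to[n]$, and let $M$ be the resulting $n\times n$ biadjacency matrix of $\hat\Gamma$. Then $$\det(M) = |\{\mu \in \mathrm{UMatch}(\hat\Gamma) : \mathrm{sgn}(\mu)=1\}| - |\{\mu \in \mathrm{UMatch}(\hat\Gamma) : \mathrm{sgn}(\mu)=-1\}|.$$
   Context: CFI graph $\hat\Gamma$: for each vertex $v$ of $\Gamma$ with neighbour set $N(v)$ (of size 3), introduce a set $I_v$ of four inner vertices $v_S$, one for each $S\subseteq N(v)$ of even size, and a set $O_v$ of six outer vertices $(v,u,0),(v,u,1)$ for $u\in N(v)$; add an edge between $v_S$ and $(v,u,1)$ if $u\in S$ and between $v_S$ and $(v,u,0)$ if $u\notin S$. For each edge $e=\{u,v\}\in E$ add two edges: $e_0$ joining $(v,u,0)$ and $(u,v,0)$, and $e_1$ joining $(v,u,1)$ and $(u,v,1)$. Let $X=\bigcup_{v\in U} I_v\cup\bigcup_{v\in V}O_v$ and $Y=\bigcup_{v\in V}I_v\cup\bigcup_{v\in U}O_v$; every edge of $\hat\Gamma$ joins $X$ and $Y$. The biadjacency matrix $M$ has $M(\eta(x),\eta'(y))=1$ if $x,y$ are adjacent and $0$ otherwise; its determinant is computed over the integers. A perfect matching of $\hat\Gamma$ is identified with a bijection $\mu:X\to Y$ with $\mu(x)$ adjacent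 to $x$ for all $x$; its sign $\mathrm{sgn}(\mu)$ is the sign of the permutation $\eta'\circ\mu\circ\eta^{ -1}$ of $[n]$. A perfect matching is uniform if for every $e\in E$ at most one of $e_0,e_1$ belongs to it; $\mathrm{UMatch}(\hat\Gamma)$ is the set of uniform perfect matchings. -}

module Defs where

open import Data.Nat using (ℕ; zero; suc; _<ᵇ_)
open import Data.Bool using (Bool; true; false; T; _∧_; _∨_; not; _xor_; if_then_else_)
open import Data.Fin using (Fin; toℕ; _≟_)
open import Data.Fin.Subset using (Subset; ∣_∣)
open import Data.Vec using (Vec; tabulate; lookup; foldr; zipWith)
import Data.Vec.Functional
open import Data.List using (List; []; _∷_; map; concatMap; filterᵇ; length; allFin)
open import Data.Bool.ListAction using (all; any)
import Data.List as L
open import Data.Integer using (ℤ; 0ℤ; 1ℤ; -1ℤ; _+_; _*_; _-_; +_)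
import Data.Integer as ℤ
open import Relation.Nullary.Decidable using (⌊_⌋)
open import Function.Bundles using (_↔_; Inverse)

evenᵇ : ℕ → Bool
evenᵇ zero = true
evenᵇ (suc n) = not (evenᵇ n)

_==F_ : ∀ {n} → Fin n → Fin n → Bool
i ==F j = ⌊ i ≟ j ⌋

_==B_ : Bool → Bool → Bool
a ==B b = not (a xor b)

_⊆ᵇ_ : ∀ {n} → Subset n → Subset n → Bool
S ⊆ᵇ T′ = foldr _ _∧_ true (zipWith (λ a b → not a ∨ b) S T′)

guard : (b : Bool) → (T b → Bool) → Bool
guard false _ = true
guard true  f = f _

funs : (a b : ℕ) → List (Fin a → Fin b)
funs zero    b = (λ ()) ∷ []
funs (suc a) b = concatMap (λ j → map (λ f → j Data.Vec.Functional.∷ f) (funs a b)) (allFin b)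

isBijᵇ : ∀ {n} → (Fin n → Fin n) → Bool
isBijᵇ {n} f =
  all (λ i → all (λ j → not (f i ==F f j) ∨ (i ==F j)) (allFin n)) (allFin n)
  ∧ all (λ j → any (λ i → f i ==F j) (allFin n)) (allFin n)

perms : (n : ℕ) → List (Fin n → Fin n)
perms n = filterᵇ isBijᵇ (funs n n)

inversions : ∀ {n} → (Fin n → Fin n) → ℕ
inversions {n} π =
  length (filterᵇ (λ ij → (toℕ (ij .Data.Product.proj₁) <ᵇ toℕ (ij .Data.Product.proj₂))
                         ∧ (toℕ (π (ij .Data.Product.proj₂)) <ᵇ toℕ (π (ij .Data.Product.proj₁))))
          (concatMap (λ i → map (λ j → i Data.Product., j) (allFin n)) (allFin n)))
  where import Data.Product

sgn : ∀ {n} → (Fin n → Fin n) → ℤ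
sgn π = if evenᵇ (inversions π) then 1ℤ else -1ℤ

sumℤ : List ℤ → ℤ
sumℤ = L.foldr _+_ 0ℤ

prodℤ : List ℤ → ℤ
prodℤ = L.foldr _*_ 1ℤ

det : ∀ {n} → (Fin n → Fin n → ℤ) → ℤ
det {n} A = sumℤ (map (λ π → sgn π * prodℤ (map (λ i → A i (π i)) (allFin n))) (perms n))

-- Bipartite graphs Γ = (U ∪ V, E) with U = Fin m, V = Fin k,
-- given by adj : Fin m → Fin k → Bool  ({u,v} ∈ E  iff  adj u v ≡ true)

module CFI {m k : ℕ} (adj : Fin m → Fin k → Bool) where

  NU : Fin m → Subset k
  NU u = tabulate (adj u)

  NV : Fin k → Subset m
  NV v = tabulate (λ u → adj u v)

  Cubic : Set
  Cubic = (∀ u → ∣ NU u ∣ ≡ 3) × (∀ v → ∣ NV v ∣ ≡ 3)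
    where open import Relation.Binary.PropositionalEquality using (_≡_)
          open import Data.Product using (_×_)

  -- X = ⋃_{u∈U} I_u ∪ ⋃_{v∈V} O_v
  -- inX u S : the inner vertex u_S (S ⊆ N(u), |S| even)
  -- outX v u e b : the outer vertex (v,u,b) with u ∈ N(v); b = false is 0, true is 1
  data X : Set where
    inX  : (u : Fin m) (S : Subset k) → T ((S ⊆ᵇ NU u) ∧ evenᵇ ∣ S ∣) → X
    outX : (v : Fin k) (u : Fin m) → T (adj u v) → Bool → X

  -- Y = ⋃_{v∈V} I_v ∪ ⋃_{u∈U} O_u
  data Y : Set where
    inY  : (v : Fin k) (S : Subset m) → T ((S ⊆ᵇ NV v) ∧ evenᵇ ∣ S ∣) → Y
    outY : (u : Fin m) (v : Fin k) → T (adj u v) → Bool → Y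

  adjXY : X → Y → Bool
  adjXY (inX u S _) (outY u′ v _ b) = (u ==F u′) ∧ (b ==B lookup S v)
  adjXY (inX _ _ _) (inY _ _ _) = false
  adjXY (outX v u _ b) (inY v′ S _) = (v ==F v′) ∧ (b ==B lookup S u)
  -- e_b joins (v,u,b) and (u,v,b)
  adjXY (outX v u _ b) (outY u′ v′ _ b′) = (u ==F u′) ∧ (v ==F v′) ∧ (b ==B b′)

  module _ {n : ℕ} (η : X ↔ Fin n) (η′ : Y ↔ Fin n) where
    open Inverse

    M : Fin n → Fin n → ℤ
    M i j = if adjXY (from η i) (from η′ j) then 1ℤ else 0ℤ

    -- A perfect matching μ : X → Y is identified with the permutation
    -- π = η′ ∘ μ ∘ η⁻¹ of [n]  (μ = η′⁻¹ ∘ π ∘ η).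
    isMatchingᵇ : (Fin n → Fin n) → Bool
    isMatchingᵇ π = all (λ i → adjXY (from η i) (from η′ (π i))) (allFin n)

    -- e_b ∈ μ  iff  μ (v,u,b) = (u,v,b)
    uniformᵇ : (Fin n → Fin n) → Bool
    uniformᵇ π =
      all (λ u → all (λ v → guard (adj u v) (λ e →
             not ((π (to η (outX v u e false)) ==F to η′ (outY u v e false))
                ∧ (π (to η (outX v u e true)) ==F to η′ (outY u v e true)))))
          (allFin k)) (allFin m)

    #UMatchSgn : ℤ → ℕ
    #UMatchSgn s = length (filterᵇ (λ π → isMatchingᵇ π ∧ uniformᵇ π ∧ ⌊ sgn π ℤ.≟ s ⌋) (perms n))

-- Expanding det M by the Leibniz formula, a permutation contributes its sign exactly when it is
-- a perfect matching of the CFI graph, so det M is the signed number of perfect matchings, and it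
-- suffices to cancel the non-uniform ones against each other. Suppose a matching uses both e₀ and e₁
-- for an edge e = {u,v}. Then (u,v,0) and (u,v,1) are taken, so the four inner vertices of u are
-- matched into the four outer vertices (u,w,β) at the other two neighbours w of u; these eight
-- vertices form a cycle of the CFI graph, which has exactly two perfect matchings. Switching between
-- them at the first such edge e (which the switch does not change) composes the permutation with a
-- 4-cycle and so flips its sign: a sign-reversing involution on the non-uniform perfect matchings.

module Submission where

open import Defs
open import Data.Nat as ℕ using (ℕ; zero; suc; _<ᵇ_)
import Data.Nat.Properties as ℕP
open import Data.Bool using (Bool; true; false; T; T?; _∧_; _∨_; not; _xor_; if_then_else_)
import Data.Bool.Properties as BP
open import Data.Bool.ListAction using (and; or; all; any)
open import Data.List using (List; []; _∷_; map; concatMap; filterᵇ; length; allFin; tabulate; _++_; cartesianProductWith)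
import Data.List.Properties as LP
open import Data.Nat.ListAction using (sum)
open import Data.Fin as F using (Fin; toℕ)
import Data.Fin.Properties as FP
open import Data.Integer as ℤ using (ℤ; 0ℤ; 1ℤ; -1ℤ; _+_; _-_; _*_; +_; -_)
import Data.Integer.Properties as ℤP
open import Data.Integer.Tactic.RingSolver using (solve-∀)
open import Data.Vec as V using (Vec)
import Data.Vec.Properties as VP
import Data.Vec.Functional as VF
open import Data.List.Membership.Propositional using (_∈_; lose)
import Data.List.Membership.Propositional.Properties as MemP
open import Data.List.Relation.Unary.Any as Any using (here; there)
import Data.List.Relation.Unary.Any.Properties as AnyP
import Data.List.Relation.Unary.All.Properties as AllP
open import Data.List.Relation.Unary.All as All using ([])
open import Data.List.Relation.Unary.AllPairs using (_∷_; [])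
open import Data.List.Relation.Unary.Unique.Propositional using (Unique)
import Data.List.Relation.Unary.Unique.Propositional.Properties as UP
open import Data.List.Relation.Binary.Permutation.Propositional using (_↭_; ↭⇒↭ₛ)
open import Data.List.Relation.Binary.Permutation.Setoid.Properties using (foldr-commMonoid)
import Data.List.Relation.Binary.Permutation.Propositional.Properties as PermP
open import Data.List.Membership.Propositional.Properties.WithK using (unique∧set⇒bag)
open import Data.List.Relation.Binary.BagAndSetEquality using (∼bag⇒↭)
open import Data.Product using (Σ; _×_; _,_; proj₁; proj₂)
open import Data.Empty using (⊥-elim)
open import Data.Sum as Sum using (_⊎_; inj₁; inj₂)
open import Data.Maybe using (Maybe; just; nothing; is-nothing; _<∣>_)
open import Data.Fin.Subset using (∣_∣)
open import Relation.Nullary.Decidable using (⌊_⌋)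
open import Relation.Nullary using (Dec; yes; no; ¬_)
open import Relation.Binary using (Tri; tri<; tri≈; tri>)
open import Relation.Binary.PropositionalEquality
open import Function using (_∘_; _$_; flip)
open import Function.Bundles using (_↔_; Inverse; Equivalence; mk⇔)
open import Function.Definitions using (Injective; StrictlySurjective)
open import Data.Fin.Permutation.Components using (transpose; transpose-inverse)

==F-refl : ∀ {n} (i : Fin n) → (i ==F i) ≡ true
==F-refl i with i F.≟ i
... | yes _ = refl
... | no i≢i = ⊥-elim (i≢i refl)

==F⇒≡ : ∀ {n} {i j : Fin n} → (i ==F j) ≡ true → i ≡ j
==F⇒≡ {i = i} {j} i==j with i F.≟ j
... | yes i≡j = i≡j

≢⇒==F≡false : ∀ {n} {i j : Fin n} → ¬ i ≡ j → (i ==F j) ≡ false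
≢⇒==F≡false {i = i} {j} i≢j with i F.≟ j
... | yes i≡j = ⊥-elim (i≢j i≡j)
... | no _ = refl

==F-suc : ∀ {n} (i j : Fin n) → (F.suc i ==F F.suc j) ≡ (i ==F j)
==F-suc i j with i F.≟ j
... | yes refl = refl
... | no _ = refl

==B-refl : ∀ b → (b ==B b) ≡ true
==B-refl true = refl
==B-refl false = refl

==B⇒≡ : ∀ {a b} → (a ==B b) ≡ true → a ≡ b
==B⇒≡ {true} {true} _ = refl
==B⇒≡ {false} {false} _ = refl

T⇒≡true : ∀ {b} → T b → b ≡ true
T⇒≡true = Equivalence.to BP.T-≡

≡true⇒T : ∀ {b} → b ≡ true → T b
≡true⇒T = Equivalence.from BP.T-≡

all-lookup : ∀ {A : Set} (p : A → Bool) {xs} → all p xs ≡ true → ∀ {x} → x ∈ xs → p x ≡ true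
all-lookup p {xs} all≡true x∈xs = T⇒≡true (All.lookup (AllP.all⁺ p xs (≡true⇒T all≡true)) x∈xs)

all-tabulate : ∀ {A : Set} (p : A → Bool) xs → (∀ x → p x ≡ true) → all p xs ≡ true
all-tabulate p xs p≡true = T⇒≡true (AllP.all⁻ p {xs} (All.tabulate (λ {x} _ → ≡true⇒T (p≡true x))))

all-cong : ∀ {A : Set} {p q : A → Bool} → p ≗ q → ∀ xs → all p xs ≡ all q xs
all-cong p≗q xs = cong and (LP.map-cong p≗q xs)

any-cong : ∀ {A : Set} {p q : A → Bool} → p ≗ q → ∀ xs → any p xs ≡ any q xs
any-cong p≗q xs = cong or (LP.map-cong p≗q xs)

∧≡true-split : ∀ {a b} → a ∧ b ≡ true → a ≡ true × b ≡ true
∧≡true-split {true} {true} _ = refl , refl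

pairSet : ∀ {k} → Fin k → Fin k → Fin k → Bool
pairSet p q x = (x ==F p) ∨ (x ==F q)

pairSet-ˡ : ∀ {k} (p q : Fin k) → pairSet p q p ≡ true
pairSet-ˡ p q rewrite ==F-refl p = refl

pairSet-ʳ : ∀ {k} (p q : Fin k) → pairSet p q q ≡ true
pairSet-ʳ p q rewrite ==F-refl q = BP.∨-zeroʳ (q ==F p)

pairSet-∉ : ∀ {k} {p q x : Fin k} → ¬ x ≡ p → ¬ x ≡ q → pairSet p q x ≡ false
pairSet-∉ x≢p x≢q rewrite ≢⇒==F≡false x≢p | ≢⇒==F≡false x≢q = refl

firstJust : ∀ {A C : Set} → (A → Maybe C) → List A → Maybe C
firstJust f [] = nothing
firstJust f (x ∷ xs) = f x <∣> firstJust f xs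

all-is-nothing≡is-nothing-firstJust : ∀ {A C : Set} (f : A → Maybe C) xs →
  all (is-nothing ∘ f) xs ≡ is-nothing (firstJust f xs)
all-is-nothing≡is-nothing-firstJust f [] = refl
all-is-nothing≡is-nothing-firstJust f (x ∷ xs) with f x
... | nothing = all-is-nothing≡is-nothing-firstJust f xs
... | just _ = refl

firstJust≡just : ∀ {A C : Set} (f : A → Maybe C) xs {c} → firstJust f xs ≡ just c → Σ A λ x → f x ≡ just c
firstJust≡just f (x ∷ xs) first≡c with f x in fx≡
... | just _ = x , trans fx≡ first≡c
... | nothing = firstJust≡just f xs first≡c

firstJust-cong : ∀ {A C : Set} {f g : A → Maybe C} → f ≗ g → ∀ xs → firstJust f xs ≡ firstJust g xs
firstJust-cong f≗g [] = refl
firstJust-cong f≗g (x ∷ xs) = cong₂ _<∣>_ (f≗g x) (firstJust-cong f≗g xs)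

whenT : ∀ {C : Set} (b : Bool) → (T b → Maybe C) → Maybe C
whenT false _ = nothing
whenT true f = f _

whenT≡just : ∀ {C : Set} b {f : T b → Maybe C} {c} → whenT b f ≡ just c → Σ (T b) λ t → f t ≡ just c
whenT≡just true f≡c = _ , f≡c

whenT-cong : ∀ {C : Set} b {f g : T b → Maybe C} → f ≗ g → whenT b f ≡ whenT b g
whenT-cong false f≗g = refl
whenT-cong true f≗g = f≗g _

guard-not≡is-nothing : ∀ {C : Set} b (d : T b → Bool) (c : T b → C) →
  guard b (not ∘ d) ≡ is-nothing (whenT b (λ t → if d t then just (c t) else nothing))
guard-not≡is-nothing false d c = refl
guard-not≡is-nothing true d c with d _
... | true = refl
... | false = refl

count : ∀ {A : Set} → (A → Bool) → List A → ℕ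
count p xs = length (filterᵇ p xs)

count-∷ : ∀ {A : Set} (p : A → Bool) x xs →
  count p (x ∷ xs) ≡ (if p x then suc (count p xs) else count p xs)
count-∷ p x xs with p x
... | true = refl
... | false = refl

count-cong : ∀ {A : Set} {p q : A → Bool} → p ≗ q → ∀ xs → count p xs ≡ count q xs
count-cong p≗q [] = refl
count-cong {p = p} {q} p≗q (x ∷ xs)
  rewrite count-∷ p x xs | count-∷ q x xs | p≗q x | count-cong p≗q xs = refl

count-++ : ∀ {A : Set} (p : A → Bool) xs ys → count p (xs ++ ys) ≡ count p xs ℕ.+ count p ys
count-++ p [] ys = refl
count-++ p (x ∷ xs) ys rewrite count-∷ p x (xs ++ ys) | count-∷ p x xs with p x
... | true = cong suc (count-++ p xs ys)
... | false = count-++ p xs ys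

count-map : ∀ {A B : Set} (p : B → Bool) (f : A → B) xs → count p (map f xs) ≡ count (p ∘ f) xs
count-map p f [] = refl
count-map p f (x ∷ xs) rewrite count-∷ p (f x) (map f xs) | count-∷ (p ∘ f) x xs with p (f x)
... | true = cong suc (count-map p f xs)
... | false = count-map p f xs

count-concatMap : ∀ {A B : Set} (p : B → Bool) (f : A → List B) xs →
  count p (concatMap f xs) ≡ sum (map (count p ∘ f) xs)
count-concatMap p f [] = refl
count-concatMap p f (x ∷ xs) =
  trans (count-++ p (f x) (concatMap f xs)) (cong (count p (f x) ℕ.+_) (count-concatMap p f xs))

count-false : ∀ {A : Set} (p : A → Bool) → (∀ x → p x ≡ false) → ∀ xs → count p xs ≡ 0
count-false p p≡false [] = refl
count-false p p≡false (x ∷ xs) rewrite count-∷ p x xs | p≡false x = count-false p p≡false xs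

count-split : ∀ {A : Set} (p q : A → Bool) xs →
  count p xs ≡ count (λ x → p x ∧ q x) xs ℕ.+ count (λ x → p x ∧ not (q x)) xs
count-split p q [] = refl
count-split p q (x ∷ xs)
  rewrite count-∷ p x xs | count-∷ (λ x → p x ∧ q x) x xs | count-∷ (λ x → p x ∧ not (q x)) x xs
  with p x | q x
... | true | true = cong suc (count-split p q xs)
... | true | false = trans (cong suc (count-split p q xs)) (sym (ℕP.+-suc _ _))
... | false | _ = count-split p q xs

count-∨-disjoint : ∀ {A : Set} (p q : A → Bool) → (∀ x → p x ≡ true → q x ≡ false) → ∀ xs →
  count (λ x → p x ∨ q x) xs ≡ count p xs ℕ.+ count q xs
count-∨-disjoint p q disjoint [] = refl
count-∨-disjoint p q disjoint (x ∷ xs)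
  rewrite count-∷ (λ x → p x ∨ q x) x xs | count-∷ p x xs | count-∷ q x xs
  with p x in px | q x in qx
... | true | true with () ← trans (sym qx) (disjoint x px)
... | true | false = cong suc (count-∨-disjoint p q disjoint xs)
... | false | true = trans (cong suc (count-∨-disjoint p q disjoint xs)) (sym (ℕP.+-suc _ _))
... | false | false = count-∨-disjoint p q disjoint xs

allFin-suc : ∀ n → allFin (suc n) ≡ F.zero ∷ map F.suc (allFin n)
allFin-suc n = cong (F.zero ∷_) (sym (LP.map-tabulate (λ i → i) F.suc))

count-allFin-suc : ∀ {k} (f : Fin (suc k) → Bool) →
  count f (allFin (suc k)) ≡ (if f F.zero then suc (count (f ∘ F.suc) (allFin k)) else count (f ∘ F.suc) (allFin k))
count-allFin-suc {k} f = begin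
  count f (allFin (suc k))               ≡⟨ cong (count f) (allFin-suc k) ⟩
  count f (F.zero ∷ map F.suc (allFin k)) ≡⟨ count-∷ f F.zero _ ⟩
  (if f F.zero then suc (count f (map F.suc (allFin k))) else count f (map F.suc (allFin k)))
    ≡⟨ cong (λ c → if f F.zero then suc c else c) (count-map f F.suc (allFin k)) ⟩
  (if f F.zero then suc (count (f ∘ F.suc) (allFin k)) else count (f ∘ F.suc) (allFin k)) ∎
  where open ≡-Reasoning

count-==F : ∀ n (a : Fin n) → count (_==F a) (allFin n) ≡ 1
count-==F (suc n) F.zero =
  trans (count-allFin-suc {n} (_==F F.zero)) (cong suc (count-false _ (λ _ → refl) (allFin n)))
count-==F (suc n) (F.suc a) =
  trans (count-allFin-suc {n} (_==F F.suc a)) (trans (count-cong (λ i → ==F-suc i a) (allFin n)) (count-==F n a))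

sum-==F : ∀ n (a : Fin n) (c : ℕ) → sum (map (λ i → if i ==F a then c else 0) (allFin n)) ≡ c
sum-==F n a c = trans (cong sum (LP.map-tabulate (λ i → i) (λ i → if i ==F a then c else 0))) (sum-tabulate n a)
  where
  sum-zeros : ∀ n → sum (tabulate {n = n} (λ _ → 0)) ≡ 0
  sum-zeros zero = refl
  sum-zeros (suc n) = sum-zeros n
  sum-tabulate : ∀ n (a : Fin n) → sum (tabulate (λ i → if i ==F a then c else 0)) ≡ c
  sum-tabulate (suc n) F.zero = trans (cong (c ℕ.+_) (sum-zeros n)) (ℕP.+-identityʳ c)
  sum-tabulate (suc n) (F.suc a) =
    trans (cong sum (LP.tabulate-cong (λ i → cong (if_then c else 0) (==F-suc i a)))) (sum-tabulate n a)

evenᵇ-count-∷ : ∀ {A : Set} (p : A → Bool) x xs → evenᵇ (count p (x ∷ xs)) ≡ p x xor evenᵇ (count p xs)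
evenᵇ-count-∷ p x xs with p x
... | true = refl
... | false = refl

evenᵇ-count-xor : ∀ {A : Set} (p q : A → Bool) xs →
  evenᵇ (count (λ x → p x xor q x) xs) ≡ not (evenᵇ (count p xs) xor evenᵇ (count q xs))
evenᵇ-count-xor p q [] = refl
evenᵇ-count-xor p q (x ∷ xs)
  rewrite evenᵇ-count-∷ (λ x → p x xor q x) x xs | evenᵇ-count-∷ p x xs | evenᵇ-count-∷ q x xs
        | evenᵇ-count-xor p q xs
  with p x | q x
... | true  | true  = cong not (sym (BP.xor-annihilates-not (evenᵇ (count p xs)) _))
... | true  | false = cong not (BP.not-distribˡ-xor (evenᵇ (count p xs)) _)
... | false | true  = cong not (BP.not-distribʳ-xor (evenᵇ (count p xs)) _)
... | false | false = refl

card-tabulate : ∀ {k} (f : Fin k → Bool) → ∣ V.tabulate f ∣ ≡ count f (allFin k)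
card-tabulate {zero} f = refl
card-tabulate {suc k} f rewrite count-allFin-suc f with f F.zero
... | true = cong suc (card-tabulate (f ∘ F.suc))
... | false = card-tabulate (f ∘ F.suc)

⊆ᵇ-tabulate : ∀ {k} (f g : Fin k → Bool) → (∀ x → f x ≡ true → g x ≡ true) →
  (V.tabulate f ⊆ᵇ V.tabulate g) ≡ true
⊆ᵇ-tabulate {zero} f g f⊆g = refl
⊆ᵇ-tabulate {suc k} f g f⊆g with f F.zero in f0
... | false = ⊆ᵇ-tabulate (f ∘ F.suc) (g ∘ F.suc) (f⊆g ∘ F.suc)
... | true rewrite f⊆g F.zero f0 = ⊆ᵇ-tabulate (f ∘ F.suc) (g ∘ F.suc) (f⊆g ∘ F.suc)

-- Permutations and their signs

isBijᵇ-sound : ∀ {n} {π : Fin n → Fin n} → isBijᵇ π ≡ true →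
  Injective _≡_ _≡_ π × StrictlySurjective _≡_ π
isBijᵇ-sound {n} {π} isBij = injective , surjective
  where
  injective : Injective _≡_ _≡_ π
  injective {i} {j} πi≡πj = ==F⇒≡ (subst (λ b → (not b ∨ (i ==F j)) ≡ true)
    (trans (cong (_==F π j) πi≡πj) (==F-refl (π j)))
    (all-lookup _ (all-lookup _ (proj₁ (∧≡true-split isBij)) (MemP.∈-allFin i)) (MemP.∈-allFin j)))
  surjective : StrictlySurjective _≡_ π
  surjective j = let i , πi==j = Any.satisfied (AnyP.any⁻ _ (allFin n)
                       (≡true⇒T (all-lookup _ (proj₂ (∧≡true-split isBij)) (MemP.∈-allFin j))))
                 in i , ==F⇒≡ (T⇒≡true πi==j)

isBijᵇ-complete : ∀ {n} {π : Fin n → Fin n} → Injective _≡_ _≡_ π → StrictlySurjective _≡_ π →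
  isBijᵇ π ≡ true
isBijᵇ-complete {n} {π} injective surjective = cong₂ _∧_
  (all-tabulate _ (allFin n) (λ i → all-tabulate _ (allFin n) (injective-at i)))
  (all-tabulate _ (allFin n) (λ j → let i , πi≡j = surjective j in
    T⇒≡true (AnyP.any⁺ _ (lose (MemP.∈-allFin i) (≡true⇒T (trans (cong (_==F j) πi≡j) (==F-refl j)))))))
  where
  injective-at : ∀ i j → (not (π i ==F π j) ∨ (i ==F j)) ≡ true
  injective-at i j with π i F.≟ π j
  ... | no _ = refl
  ... | yes πi≡πj rewrite injective πi≡πj | ==F-refl j = refl

isBijᵇ-cong : ∀ {n} {π ρ : Fin n → Fin n} → π ≗ ρ → isBijᵇ π ≡ isBijᵇ ρ
isBijᵇ-cong {n} π≗ρ = cong₂ _∧_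
  (all-cong (λ i → all-cong (λ j → cong₂ (λ πi πj → not (πi ==F πj) ∨ (i ==F j)) (π≗ρ i) (π≗ρ j))
    (allFin n)) (allFin n))
  (all-cong (λ j → any-cong (λ i → cong (_==F j) (π≗ρ i)) (allFin n)) (allFin n))

transpose-ˡ : ∀ {n} (i j : Fin n) → transpose i j i ≡ j
transpose-ˡ i j with i F.≟ i
... | yes _ = refl
... | no i≢i = ⊥-elim (i≢i refl)

transpose-ʳ : ∀ {n} (i j : Fin n) → transpose i j j ≡ i
transpose-ʳ i j with j F.≟ i
... | yes refl = refl
... | no _ with j F.≟ j
...   | yes _ = refl
...   | no j≢j = ⊥-elim (j≢j refl)

transpose-fix : ∀ {n} {i j k : Fin n} → ¬ k ≡ i → ¬ k ≡ j → transpose i j k ≡ k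
transpose-fix {i = i} {j} {k} k≢i k≢j with k F.≟ i
... | yes k≡i = ⊥-elim (k≢i k≡i)
... | no _ with k F.≟ j
...   | yes k≡j = ⊥-elim (k≢j k≡j)
...   | no _ = refl

transpose-comm : ∀ {n} (i j k : Fin n) → transpose i j k ≡ transpose j i k
transpose-comm i j k = by-cases (k F.≟ i) (k F.≟ j)
  where
  by-cases : Dec (k ≡ i) → Dec (k ≡ j) → transpose i j k ≡ transpose j i k
  by-cases (yes refl) _ = trans (transpose-ˡ k j) (sym (transpose-ʳ j k))
  by-cases (no _) (yes refl) = trans (transpose-ʳ i k) (sym (transpose-ˡ k i))
  by-cases (no k≢i) (no k≢j) = trans (transpose-fix k≢i k≢j) (sym (transpose-fix k≢j k≢i))

transpose-involutive : ∀ {n} (i j k : Fin n) → transpose i j (transpose i j k) ≡ k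
transpose-involutive i j k = trans (cong (transpose i j) (transpose-comm i j k)) (transpose-inverse i j)

transpose-injective : ∀ {n} (i j : Fin n) {π : Fin n → Fin n} →
  Injective _≡_ _≡_ π → Injective _≡_ _≡_ (transpose i j ∘ π)
transpose-injective i j {π} π-inj {x} {y} eq = π-inj (begin
  π x                             ≡⟨ transpose-involutive i j (π x) ⟨
  transpose i j (transpose i j (π x)) ≡⟨ cong (transpose i j) eq ⟩
  transpose i j (transpose i j (π y)) ≡⟨ transpose-involutive i j (π y) ⟩
  π y                             ∎)
  where open ≡-Reasoning

transpose-surjective : ∀ {n} (i j : Fin n) {π : Fin n → Fin n} →
  StrictlySurjective _≡_ π → StrictlySurjective _≡_ (transpose i j ∘ π)
transpose-surjective i j π-surj y with π-surj (transpose i j y)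
... | x , πx≡ = x , trans (cong (transpose i j) πx≡) (transpose-involutive i j y)

pairs : ∀ n → List (Fin n × Fin n)
pairs n = concatMap (λ i → map (i ,_) (allFin n)) (allFin n)

isInversion : ∀ {n} → (Fin n → Fin n) → Fin n × Fin n → Bool
isInversion π ij = (toℕ (proj₁ ij) <ᵇ toℕ (proj₂ ij)) ∧ (toℕ (π (proj₂ ij)) <ᵇ toℕ (π (proj₁ ij)))

inversions-cong : ∀ {n} {π ρ : Fin n → Fin n} → π ≗ ρ → inversions π ≡ inversions ρ
inversions-cong {n} π≗ρ = count-cong
  (λ (i , j) → cong₂ (λ πj πi → (toℕ i <ᵇ toℕ j) ∧ (toℕ πj <ᵇ toℕ πi)) (π≗ρ j) (π≗ρ i)) (pairs n)

sameUnorderedPair : ∀ {n} → Fin n → Fin n → Fin n → Fin n → Bool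
sameUnorderedPair a b x y = ((x ==F a) ∧ (y ==F b)) ∨ ((x ==F b) ∧ (y ==F a))

count-pairs-==F : ∀ n (a b : Fin n) → count (λ (i , j) → (i ==F a) ∧ (j ==F b)) (pairs n) ≡ 1
count-pairs-==F n a b = begin
  count isAB (pairs n)
    ≡⟨ count-concatMap isAB (λ i → map (i ,_) (allFin n)) (allFin n) ⟩
  sum (map (λ i → count isAB (map (i ,_) (allFin n))) (allFin n))
    ≡⟨ cong sum (LP.map-cong row (allFin n)) ⟩
  sum (map (λ i → if i ==F a then 1 else 0) (allFin n))
    ≡⟨ sum-==F n a 1 ⟩
  1 ∎
  where
  open ≡-Reasoning
  isAB : Fin n × Fin n → Bool
  isAB (i , j) = (i ==F a) ∧ (j ==F b)
  row : ∀ i → count isAB (map (i ,_) (allFin n)) ≡ (if i ==F a then 1 else 0)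
  row i rewrite count-map isAB (i ,_) (allFin n) with i ==F a
  ... | true = count-==F n b
  ... | false = count-false _ (λ _ → refl) (allFin n)

<ᵇ≡true : ∀ {m n} → m ℕ.< n → (m <ᵇ n) ≡ true
<ᵇ≡true m<n = Equivalence.to BP.T-≡ (ℕP.<⇒<ᵇ m<n)

>⇒<ᵇ≡false : ∀ {m n} → n ℕ.< m → (m <ᵇ n) ≡ false
>⇒<ᵇ≡false {m} {n} n<m with m <ᵇ n in m<ᵇn
... | false = refl
... | true = ⊥-elim (ℕP.<-asym n<m (ℕP.<ᵇ⇒< m n (Equivalence.from BP.T-≡ m<ᵇn)))

count-ordered-sameUnorderedPair : ∀ {n} (a b : Fin n) → ¬ a ≡ b →
  count (λ (i , j) → (toℕ i <ᵇ toℕ j) ∧ sameUnorderedPair a b i j) (pairs n) ≡ 1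
count-ordered-sameUnorderedPair {n} a b a≢b = by-cmp (ℕP.<-cmp (toℕ a) (toℕ b))
  where
  lowFirst : ∀ a b → toℕ a ℕ.< toℕ b → ∀ ((i , j) : Fin n × Fin n) →
    ((toℕ i <ᵇ toℕ j) ∧ sameUnorderedPair a b i j) ≡ ((i ==F a) ∧ (j ==F b))
  lowFirst a b a<b (i , j) with i F.≟ a | i F.≟ b | j F.≟ a | j F.≟ b
  ... | yes refl | yes refl | _ | _ = ⊥-elim (ℕP.<-irrefl refl a<b)
  ... | _ | _ | yes refl | yes refl = ⊥-elim (ℕP.<-irrefl refl a<b)
  ... | yes refl | no _ | no _ | yes refl = trans (BP.∧-identityʳ _) (<ᵇ≡true a<b)
  ... | no _ | yes refl | yes refl | no _ = trans (BP.∧-identityʳ _) (>⇒<ᵇ≡false a<b)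
  ... | yes refl | no _ | yes refl | no _ = BP.∧-zeroʳ _
  ... | yes refl | no _ | no _ | no _ = BP.∧-zeroʳ _
  ... | no _ | yes refl | no _ | yes refl = BP.∧-zeroʳ _
  ... | no _ | yes refl | no _ | no _ = BP.∧-zeroʳ _
  ... | no _ | no _ | yes refl | no _ = BP.∧-zeroʳ _
  ... | no _ | no _ | no _ | yes refl = BP.∧-zeroʳ _
  ... | no _ | no _ | no _ | no _ = BP.∧-zeroʳ _
  by-cmp : Tri (toℕ a ℕ.< toℕ b) (toℕ a ≡ toℕ b) (toℕ b ℕ.< toℕ a) →
    count (λ (i , j) → (toℕ i <ᵇ toℕ j) ∧ sameUnorderedPair a b i j) (pairs n) ≡ 1
  by-cmp (tri< a<b _ _) = trans (count-cong (lowFirst a b a<b) (pairs n)) (count-pairs-==F n a b)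
  by-cmp (tri≈ _ a≡b _) = ⊥-elim (a≢b (FP.toℕ-injective a≡b))
  by-cmp (tri> _ _ b<a) = trans (count-cong (λ (i , j) → trans
      (cong ((toℕ i <ᵇ toℕ j) ∧_) (BP.∨-comm ((i ==F a) ∧ (j ==F b)) _)) (lowFirst b a b<a (i , j))) (pairs n))
    (count-pairs-==F n b a)

<ᵇ-irrefl : ∀ m → (m <ᵇ m) ≡ false
<ᵇ-irrefl zero = refl
<ᵇ-irrefl (suc m) = <ᵇ-irrefl m

<ᵇ-suc-≢ : ∀ y c → ¬ y ≡ c → (y <ᵇ suc c) ≡ (y <ᵇ c)
<ᵇ-suc-≢ zero zero y≢c = ⊥-elim (y≢c refl)
<ᵇ-suc-≢ zero (suc c) _ = refl
<ᵇ-suc-≢ (suc y) zero _ = refl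
<ᵇ-suc-≢ (suc y) (suc c) y≢c = <ᵇ-suc-≢ y c (y≢c ∘ cong suc)

suc-<ᵇ-≢ : ∀ x c → ¬ x ≡ suc c → (suc c <ᵇ x) ≡ (c <ᵇ x)
suc-<ᵇ-≢ zero c _ = refl
suc-<ᵇ-≢ (suc x) c x≢1+c = sym (<ᵇ-suc-≢ c x (λ c≡x → x≢1+c (cong suc (sym c≡x))))

==F-preimage : ∀ {n} {π : Fin n → Fin n} → Injective _≡_ _≡_ π →
  ∀ {r d} → π r ≡ d → ∀ i → (π i ==F d) ≡ (i ==F r)
==F-preimage {π = π} π-inj {r} {d} πr≡d i with π i F.≟ d | i F.≟ r
... | yes _ | yes _ = refl
... | no _ | no _ = refl
... | yes πi≡d | no i≢r = ⊥-elim (i≢r (π-inj (trans πi≡d (sym πr≡d))))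
... | no πi≢d | yes refl = ⊥-elim (πi≢d πr≡d)

-- Stated for any s behaving like transpose c c⁺, so that splitting on x ≟ c does not unfold transpose.
module _ {n} {c c⁺ : Fin n} (c⁺≡1+c : toℕ c⁺ ≡ suc (toℕ c)) {s : Fin n → Fin n}
         (s-c : s c ≡ c⁺) (s-c⁺ : s c⁺ ≡ c) (s-fix : ∀ {z} → ¬ z ≡ c → ¬ z ≡ c⁺ → s z ≡ z) where

  private
    c≢c⁺ : ¬ c ≡ c⁺
    c≢c⁺ c≡c⁺ = ℕP.<-irrefl (trans (cong toℕ c≡c⁺) c⁺≡1+c) (ℕP.n<1+n (toℕ c))

    toℕ-≢ : ∀ {x y : Fin n} → ¬ x ≡ y → ¬ toℕ x ≡ toℕ y
    toℕ-≢ x≢y = x≢y ∘ FP.toℕ-injective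

  adjacentSwap-<ᵇ : ∀ x y → (toℕ (s y) <ᵇ toℕ (s x)) ≡ (toℕ y <ᵇ toℕ x) xor sameUnorderedPair c c⁺ x y
  adjacentSwap-<ᵇ x y with x F.≟ c | x F.≟ c⁺ | y F.≟ c | y F.≟ c⁺
  ... | yes refl | yes x≡c⁺ | _ | _ = ⊥-elim (c≢c⁺ x≡c⁺)
  ... | _ | _ | yes refl | yes y≡c⁺ = ⊥-elim (c≢c⁺ y≡c⁺)
  ... | yes refl | no _ | yes refl | no _
    rewrite s-c | <ᵇ-irrefl (toℕ c⁺) | <ᵇ-irrefl (toℕ x) = refl
  ... | yes refl | no _ | no _ | yes refl
    rewrite s-c | s-c⁺ | c⁺≡1+c | <ᵇ≡true (ℕP.n<1+n (toℕ x)) | >⇒<ᵇ≡false (ℕP.n<1+n (toℕ x)) = refl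
  ... | yes refl | no _ | no y≢c | no y≢c⁺
    rewrite s-c | s-fix y≢c y≢c⁺ | c⁺≡1+c
    = trans (<ᵇ-suc-≢ (toℕ y) (toℕ x) (toℕ-≢ y≢c)) (sym (BP.xor-identityʳ _))
  ... | no _ | yes refl | yes refl | no _
    rewrite s-c | s-c⁺ | c⁺≡1+c | <ᵇ≡true (ℕP.n<1+n (toℕ y)) | >⇒<ᵇ≡false (ℕP.n<1+n (toℕ y)) = refl
  ... | no _ | yes refl | no _ | yes refl
    rewrite s-c⁺ | <ᵇ-irrefl (toℕ c) | <ᵇ-irrefl (toℕ x) = refl
  ... | no _ | yes refl | no y≢c | no y≢c⁺
    rewrite s-c⁺ | s-fix y≢c y≢c⁺ | c⁺≡1+c
    = trans (sym (<ᵇ-suc-≢ (toℕ y) (toℕ c) (toℕ-≢ y≢c))) (sym (BP.xor-identityʳ _))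
  ... | no x≢c | no x≢c⁺ | yes refl | no _
    rewrite s-c | s-fix x≢c x≢c⁺ | c⁺≡1+c
    = trans (suc-<ᵇ-≢ (toℕ x) (toℕ y) (toℕ-≢ x≢c⁺ ∘ flip trans (sym c⁺≡1+c))) (sym (BP.xor-identityʳ _))
  ... | no x≢c | no x≢c⁺ | no _ | yes refl
    rewrite s-c⁺ | s-fix x≢c x≢c⁺ | c⁺≡1+c
    = trans (sym (suc-<ᵇ-≢ (toℕ x) (toℕ c) (toℕ-≢ x≢c⁺ ∘ flip trans (sym c⁺≡1+c)))) (sym (BP.xor-identityʳ _))
  ... | no x≢c | no x≢c⁺ | no y≢c | no y≢c⁺
    rewrite s-fix x≢c x≢c⁺ | s-fix y≢c y≢c⁺ = sym (BP.xor-identityʳ _)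

  evenᵇ-inversions-adjacentSwap : ∀ {π : Fin n → Fin n} → Injective _≡_ _≡_ π → StrictlySurjective _≡_ π →
    evenᵇ (inversions (s ∘ π)) ≡ not (evenᵇ (inversions π))
  evenᵇ-inversions-adjacentSwap {π} π-inj π-surj = begin
    evenᵇ (count (isInversion (s ∘ π)) (pairs n))
      ≡⟨ cong evenᵇ (count-cong inversion-xor (pairs n)) ⟩
    evenᵇ (count (λ ij → isInversion π ij xor swapped ij) (pairs n))
      ≡⟨ evenᵇ-count-xor (isInversion π) swapped (pairs n) ⟩
    not (evenᵇ (inversions π) xor evenᵇ (count swapped (pairs n)))
      ≡⟨ cong (λ k → not (evenᵇ (inversions π) xor evenᵇ k)) count-swapped ⟩
    not (evenᵇ (inversions π) xor false)
      ≡⟨ cong not (BP.xor-identityʳ _) ⟩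
    not (evenᵇ (inversions π)) ∎
    where
    open ≡-Reasoning
    swapped : Fin n × Fin n → Bool
    swapped (i , j) = (toℕ i <ᵇ toℕ j) ∧ sameUnorderedPair c c⁺ (π i) (π j)
    inversion-xor : ∀ ij → isInversion (s ∘ π) ij ≡ isInversion π ij xor swapped ij
    inversion-xor (i , j) = trans (cong ((toℕ i <ᵇ toℕ j) ∧_) (adjacentSwap-<ᵇ (π i) (π j)))
                                  (BP.∧-distribˡ-xor (toℕ i <ᵇ toℕ j) _ _)
    p q : Fin n
    p = proj₁ (π-surj c)
    q = proj₁ (π-surj c⁺)
    preimage : ∀ i → (π i ==F c) ≡ (i ==F p) × (π i ==F c⁺) ≡ (i ==F q)
    preimage i = ==F-preimage π-inj (proj₂ (π-surj c)) i , ==F-preimage π-inj (proj₂ (π-surj c⁺)) i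
    count-swapped : count swapped (pairs n) ≡ 1
    count-swapped = trans
      (count-cong (λ (i , j) → cong ((toℕ i <ᵇ toℕ j) ∧_)
        (cong₂ _∨_ (cong₂ _∧_ (proj₁ (preimage i)) (proj₂ (preimage j)))
                   (cong₂ _∧_ (proj₂ (preimage i)) (proj₁ (preimage j))))) (pairs n))
      (count-ordered-sameUnorderedPair p q (c≢c⁺ ∘ λ p≡q → trans (sym (proj₂ (π-surj c)))
                                                   (trans (cong π p≡q) (proj₂ (π-surj c⁺)))))

transpose-conjugate : ∀ {n} {a a⁺ b : Fin n} → ¬ a ≡ a⁺ → ¬ a ≡ b → ¬ a⁺ ≡ b →
  ∀ x → transpose a b x ≡ transpose a a⁺ (transpose a⁺ b (transpose a a⁺ x))
transpose-conjugate {a = a} {a⁺} {b} a≢a⁺ a≢b a⁺≢b x = by-cases (x F.≟ a) (x F.≟ a⁺) (x F.≟ b)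
  where
  by-cases : Dec (x ≡ a) → Dec (x ≡ a⁺) → Dec (x ≡ b) →
    transpose a b x ≡ transpose a a⁺ (transpose a⁺ b (transpose a a⁺ x))
  by-cases (yes refl) _ _
    rewrite transpose-ˡ x b | transpose-ˡ x a⁺ | transpose-ˡ a⁺ b | transpose-fix (≢-sym a≢b) (≢-sym a⁺≢b) = refl
  by-cases (no _) (yes refl) _
    rewrite transpose-fix (≢-sym a≢a⁺) a⁺≢b | transpose-ʳ a x | transpose-fix a≢a⁺ a≢b | transpose-ˡ a x = refl
  by-cases (no _) (no _) (yes refl)
    rewrite transpose-ʳ a x | transpose-fix (≢-sym a≢b) (≢-sym a⁺≢b) | transpose-ʳ a⁺ x | transpose-ʳ a a⁺ = refl
  by-cases (no x≢a) (no x≢a⁺) (no x≢b)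
    rewrite transpose-fix x≢a x≢b | transpose-fix x≢a x≢a⁺ | transpose-fix x≢a⁺ x≢b | transpose-fix x≢a x≢a⁺ = refl

evenᵇ-inversions-transpose-adjacent : ∀ {n} {a a⁺ : Fin n} → toℕ a⁺ ≡ suc (toℕ a) →
  ∀ {π} → Injective _≡_ _≡_ π → StrictlySurjective _≡_ π →
  evenᵇ (inversions (transpose a a⁺ ∘ π)) ≡ not (evenᵇ (inversions π))
evenᵇ-inversions-transpose-adjacent {a = a} {a⁺} a⁺≡1+a =
  evenᵇ-inversions-adjacentSwap a⁺≡1+a (transpose-ˡ a a⁺) (transpose-ʳ a a⁺) transpose-fix

evenᵇ-inversions-transpose-distance : ∀ {n} d (a b : Fin n) → suc (toℕ a ℕ.+ d) ≡ toℕ b →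
  ∀ {π} → Injective _≡_ _≡_ π → StrictlySurjective _≡_ π →
  evenᵇ (inversions (transpose a b ∘ π)) ≡ not (evenᵇ (inversions π))
evenᵇ-inversions-transpose-distance zero a b a+1≡b =
  evenᵇ-inversions-transpose-adjacent (trans (sym a+1≡b) (cong suc (ℕP.+-identityʳ (toℕ a))))
evenᵇ-inversions-transpose-distance {n} (suc d) a b a+2+d≡b {π} π-inj π-surj = begin
  evenᵇ (inversions (transpose a b ∘ π))
    ≡⟨ cong evenᵇ (inversions-cong (transpose-conjugate a≢a⁺ a≢b a⁺≢b ∘ π)) ⟩
  evenᵇ (inversions (t ∘ (transpose a⁺ b ∘ (t ∘ π))))
    ≡⟨ evenᵇ-inversions-transpose-adjacent a⁺≡1+a
         (transpose-injective a⁺ b (transpose-injective a a⁺ π-inj))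
         (transpose-surjective a⁺ b (transpose-surjective a a⁺ π-surj)) ⟩
  not (evenᵇ (inversions (transpose a⁺ b ∘ (t ∘ π))))
    ≡⟨ cong not (evenᵇ-inversions-transpose-distance d a⁺ b a⁺+1+d≡b
         (transpose-injective a a⁺ π-inj) (transpose-surjective a a⁺ π-surj)) ⟩
  not (not (evenᵇ (inversions (t ∘ π))))
    ≡⟨ BP.not-involutive _ ⟩
  evenᵇ (inversions (t ∘ π))
    ≡⟨ evenᵇ-inversions-transpose-adjacent a⁺≡1+a π-inj π-surj ⟩
  not (evenᵇ (inversions π)) ∎
  where
  open ≡-Reasoning
  a<b : toℕ a ℕ.< toℕ b
  a<b = subst (toℕ a ℕ.<_) a+2+d≡b (ℕ.s≤s (ℕP.m≤m+n (toℕ a) (suc d)))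
  1+a<n : suc (toℕ a) ℕ.< n
  1+a<n = ℕP.<-≤-trans (ℕ.s≤s a<b) (FP.toℕ<n b)
  a⁺ : Fin n
  a⁺ = F.fromℕ< 1+a<n
  a⁺≡1+a : toℕ a⁺ ≡ suc (toℕ a)
  a⁺≡1+a = FP.toℕ-fromℕ< 1+a<n
  t : Fin n → Fin n
  t = transpose a a⁺
  a⁺+1+d≡b : suc (toℕ a⁺ ℕ.+ d) ≡ toℕ b
  a⁺+1+d≡b = trans (cong (λ x → suc (x ℕ.+ d)) a⁺≡1+a) (trans (cong suc (sym (ℕP.+-suc (toℕ a) d))) a+2+d≡b)
  a≢a⁺ : ¬ a ≡ a⁺
  a≢a⁺ a≡a⁺ = ℕP.<-irrefl (trans (cong toℕ a≡a⁺) a⁺≡1+a) (ℕP.n<1+n (toℕ a))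
  a≢b : ¬ a ≡ b
  a≢b a≡b = ℕP.<-irrefl (cong toℕ a≡b) a<b
  a⁺≢b : ¬ a⁺ ≡ b
  a⁺≢b a⁺≡b = ℕP.<-irrefl (cong toℕ a⁺≡b) (subst (toℕ a⁺ ℕ.<_) a⁺+1+d≡b (ℕ.s≤s (ℕP.m≤m+n (toℕ a⁺) d)))

evenᵇ-inversions-transpose : ∀ {n} {a b : Fin n} → ¬ a ≡ b →
  ∀ {π} → Injective _≡_ _≡_ π → StrictlySurjective _≡_ π →
  evenᵇ (inversions (transpose a b ∘ π)) ≡ not (evenᵇ (inversions π))
evenᵇ-inversions-transpose {a = a} {b} a≢b {π} π-inj π-surj with ℕP.<-cmp (toℕ a) (toℕ b)
... | tri< a<b _ _ = let d , a+1+d≡b = ℕP.m≤n⇒∃[o]m+o≡n a<b in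
  evenᵇ-inversions-transpose-distance d a b a+1+d≡b π-inj π-surj
... | tri≈ _ a≡b _ = ⊥-elim (a≢b (FP.toℕ-injective a≡b))
... | tri> _ _ b<a = let d , b+1+d≡a = ℕP.m≤n⇒∃[o]m+o≡n b<a in
  trans (cong evenᵇ (inversions-cong (transpose-comm a b ∘ π)))
        (evenᵇ-inversions-transpose-distance d b a b+1+d≡a π-inj π-surj)

sgn-cong : ∀ {n} {π ρ : Fin n → Fin n} → π ≗ ρ → sgn π ≡ sgn ρ
sgn-cong π≗ρ = cong (λ k → if evenᵇ k then 1ℤ else -1ℤ) (inversions-cong π≗ρ)

sgn-transpose : ∀ {n} {a b : Fin n} → ¬ a ≡ b →
  ∀ {π} → Injective _≡_ _≡_ π → StrictlySurjective _≡_ π → sgn (transpose a b ∘ π) ≡ - sgn π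
sgn-transpose a≢b {π} π-inj π-surj
  rewrite evenᵇ-inversions-transpose a≢b π-inj π-surj with evenᵇ (inversions π)
... | true = refl
... | false = refl

record Distinct4 {n} (p q r s : Fin n) : Set where
  field
    p≢q : ¬ p ≡ q
    p≢r : ¬ p ≡ r
    p≢s : ¬ p ≡ s
    q≢r : ¬ q ≡ r
    q≢s : ¬ q ≡ s
    r≢s : ¬ r ≡ s

Distinct4-reverse : ∀ {n} {p q r s : Fin n} → Distinct4 p q r s → Distinct4 q p s r
Distinct4-reverse d = record
  { p≢q = p≢q ∘ sym ; p≢r = q≢s ; p≢s = q≢r ; q≢r = p≢s ; q≢s = p≢r ; r≢s = r≢s ∘ sym }
  where open Distinct4 d

cycle4 : ∀ {n} → Fin n → Fin n → Fin n → Fin n → Fin n → Fin n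
cycle4 p q r s = transpose p s ∘ transpose p r ∘ transpose p q

module _ {n} {p q r s : Fin n} (distinct : Distinct4 p q r s) where
  open Distinct4 distinct

  cycle4-p : cycle4 p q r s p ≡ q
  cycle4-p rewrite transpose-ˡ p q | transpose-fix (p≢q ∘ sym) q≢r | transpose-fix (p≢q ∘ sym) q≢s = refl

  cycle4-q : cycle4 p q r s q ≡ r
  cycle4-q rewrite transpose-ʳ p q | transpose-ˡ p r | transpose-fix (p≢r ∘ sym) r≢s = refl

  cycle4-r : cycle4 p q r s r ≡ s
  cycle4-r rewrite transpose-fix (p≢r ∘ sym) (q≢r ∘ sym) | transpose-ʳ p r | transpose-ˡ p s = refl

  cycle4-s : cycle4 p q r s s ≡ p
  cycle4-s rewrite transpose-fix (p≢s ∘ sym) (q≢s ∘ sym) | transpose-fix (p≢s ∘ sym) (r≢s ∘ sym) | transpose-ʳ p s = refl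

  cycle4-fix : ∀ {z} → ¬ z ≡ p → ¬ z ≡ q → ¬ z ≡ r → ¬ z ≡ s → cycle4 p q r s z ≡ z
  cycle4-fix z≢p z≢q z≢r z≢s rewrite transpose-fix z≢p z≢q | transpose-fix z≢p z≢r | transpose-fix z≢p z≢s = refl

  cycle4-injective : ∀ {π} → Injective _≡_ _≡_ π → Injective _≡_ _≡_ (cycle4 p q r s ∘ π)
  cycle4-injective = transpose-injective p s ∘ transpose-injective p r ∘ transpose-injective p q

  cycle4-surjective : ∀ {π} → StrictlySurjective _≡_ π → StrictlySurjective _≡_ (cycle4 p q r s ∘ π)
  cycle4-surjective = transpose-surjective p s ∘ transpose-surjective p r ∘ transpose-surjective p q

  sgn-cycle4 : ∀ {π} → Injective _≡_ _≡_ π → StrictlySurjective _≡_ π → sgn (cycle4 p q r s ∘ π) ≡ - sgn π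
  sgn-cycle4 {π} π-inj π-surj = begin
    sgn (transpose p s ∘ (transpose p r ∘ (transpose p q ∘ π)))
      ≡⟨ sgn-transpose p≢s (transpose-injective p r (transpose-injective p q π-inj))
                           (transpose-surjective p r (transpose-surjective p q π-surj)) ⟩
    - sgn (transpose p r ∘ (transpose p q ∘ π))
      ≡⟨ cong -_ (sgn-transpose p≢r (transpose-injective p q π-inj) (transpose-surjective p q π-surj)) ⟩
    - - sgn (transpose p q ∘ π)
      ≡⟨ ℤP.neg-involutive _ ⟩
    sgn (transpose p q ∘ π)
      ≡⟨ sgn-transpose p≢q π-inj π-surj ⟩
    - sgn π ∎
    where open ≡-Reasoning

cycle4-reverse-inverse : ∀ {n} {p q r s : Fin n} → Distinct4 p q r s → ∀ z → cycle4 q p s r (cycle4 p q r s z) ≡ z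
cycle4-reverse-inverse {p = p} {q} {r} {s} d z = by-cases (z F.≟ p) (z F.≟ q) (z F.≟ r) (z F.≟ s)
  where
  d′ = Distinct4-reverse d
  by-cases : Dec (z ≡ p) → Dec (z ≡ q) → Dec (z ≡ r) → Dec (z ≡ s) → cycle4 q p s r (cycle4 p q r s z) ≡ z
  by-cases (yes refl) _ _ _ = trans (cong (cycle4 q z s r) (cycle4-p d)) (cycle4-p d′)
  by-cases _ (yes refl) _ _ = trans (cong (cycle4 z p s r) (cycle4-q d)) (cycle4-s d′)
  by-cases _ _ (yes refl) _ = trans (cong (cycle4 q p s z) (cycle4-r d)) (cycle4-r d′)
  by-cases _ _ _ (yes refl) = trans (cong (cycle4 q p z r) (cycle4-s d)) (cycle4-q d′)
  by-cases (no z≢p) (no z≢q) (no z≢r) (no z≢s) =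
    trans (cong (cycle4 q p s r) (cycle4-fix d z≢p z≢q z≢r z≢s)) (cycle4-fix d′ z≢q z≢p z≢s z≢r)

-- Sums over permutations

sumℤ-↭ : ∀ {xs ys} → xs ↭ ys → sumℤ xs ≡ sumℤ ys
sumℤ-↭ xs↭ys = foldr-commMonoid (setoid ℤ) ℤP.+-0-isCommutativeMonoid (↭⇒↭ₛ xs↭ys)

sumℤ-map-neg : ∀ {A : Set} (f : A → ℤ) xs → sumℤ (map (λ x → - f x) xs) ≡ - sumℤ (map f xs)
sumℤ-map-neg f [] = refl
sumℤ-map-neg f (x ∷ xs) =
  trans (cong (_+_ (- f x)) (sumℤ-map-neg f xs)) (sym (ℤP.neg-distrib-+ (f x) (sumℤ (map f xs))))

sumℤ-map-+ : ∀ {A : Set} (f g : A → ℤ) xs →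
  sumℤ (map (λ x → f x + g x) xs) ≡ sumℤ (map f xs) + sumℤ (map g xs)
sumℤ-map-+ f g [] = refl
sumℤ-map-+ f g (x ∷ xs) =
  trans (cong (_+_ (f x + g x)) (sumℤ-map-+ f g xs)) (interchange (f x) (g x) _ _)
  where
  interchange : ∀ a b c d → (a + b) + (c + d) ≡ (a + c) + (b + d)
  interchange = solve-∀

sumℤ-map-filterᵇ : ∀ {A : Set} (f : A → ℤ) (p : A → Bool) xs →
  sumℤ (map f (filterᵇ p xs)) ≡ sumℤ (map (λ x → if p x then f x else 0ℤ) xs)
sumℤ-map-filterᵇ f p [] = refl
sumℤ-map-filterᵇ f p (x ∷ xs) with p x
... | true = cong (_+_ (f x)) (sumℤ-map-filterᵇ f p xs)
... | false = trans (sumℤ-map-filterᵇ f p xs) (sym (ℤP.+-identityˡ _))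

x≡-x⇒x≡0 : ∀ (x : ℤ) → x ≡ - x → x ≡ 0ℤ
x≡-x⇒x≡0 (+ zero) _ = refl
x≡-x⇒x≡0 (+ suc _) ()
x≡-x⇒x≡0 ℤ.-[1+ _ ] ()

allVecs : (a b : ℕ) → List (Vec (Fin b) a)
allVecs a b = map V.tabulate (funs a b)

allVecs-suc : ∀ a b → allVecs (suc a) b ≡ cartesianProductWith V._∷_ (allFin b) (allVecs a b)
allVecs-suc a b = begin
  map V.tabulate (concatMap (λ j → map (j VF.∷_) (funs a b)) (allFin b))
    ≡⟨ LP.map-concatMap V.tabulate _ (allFin b) ⟩
  concatMap (λ j → map V.tabulate (map (j VF.∷_) (funs a b))) (allFin b)
    ≡⟨ LP.concatMap-cong (λ j → trans (sym (LP.map-∘ (funs a b))) (LP.map-∘ (funs a b))) (allFin b) ⟩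
  concatMap (λ j → map (j V.∷_) (allVecs a b)) (allFin b)
    ≡⟨ concatMap-map≡cartesianProductWith (allFin b) ⟩
  cartesianProductWith V._∷_ (allFin b) (allVecs a b) ∎
  where
  open ≡-Reasoning
  concatMap-map≡cartesianProductWith : ∀ xs →
    concatMap (λ j → map (j V.∷_) (allVecs a b)) xs ≡ cartesianProductWith V._∷_ xs (allVecs a b)
  concatMap-map≡cartesianProductWith [] = refl
  concatMap-map≡cartesianProductWith (j ∷ xs) =
    cong (map (j V.∷_) (allVecs a b) ++_) (concatMap-map≡cartesianProductWith xs)

∈-allVecs : ∀ a b (v : Vec (Fin b) a) → v ∈ allVecs a b
∈-allVecs zero b V.[] = here refl
∈-allVecs (suc a) b (x V.∷ v) = subst (x V.∷ v ∈_) (sym (allVecs-suc a b))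
  (MemP.∈-cartesianProductWith⁺ V._∷_ (MemP.∈-allFin x) (∈-allVecs a b v))

allVecs-unique : ∀ a b → Unique (allVecs a b)
allVecs-unique zero b = [] ∷ []
allVecs-unique (suc a) b = subst Unique (sym (allVecs-suc a b))
  (UP.cartesianProductWith⁺ V._∷_ VP.∷-injective (UP.allFin⁺ b) (allVecs-unique a b))

-- Functions are only equal pointwise, so the involution is run on their tabulations, which allVecs
-- lists without repetition and which it therefore permutes.
sumℤ-funs-signReversingInvolution : ∀ {n} (H : (Fin n → Fin n) → ℤ) (Φ : (Fin n → Fin n) → Fin n → Fin n) →
  (∀ {π ρ} → π ≗ ρ → H π ≡ H ρ) → (∀ {π ρ} → π ≗ ρ → Φ π ≗ Φ ρ) →
  (∀ π → Φ (Φ π) ≗ π) → (∀ π → H (Φ π) ≡ - H π) →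
  sumℤ (map H (funs n n)) ≡ 0ℤ
sumℤ-funs-signReversingInvolution {n} H Φ H-cong Φ-cong Φ-involutive H∘Φ≡-H = begin
  sumℤ (map H (funs n n))
    ≡⟨ cong sumℤ (LP.map-cong (λ π → H-cong (sym ∘ VP.lookup∘tabulate π)) (funs n n)) ⟩
  sumℤ (map (h ∘ V.tabulate) (funs n n))
    ≡⟨ cong sumℤ (LP.map-∘ (funs n n)) ⟩
  sumℤ (map h vs)
    ≡⟨ x≡-x⇒x≡0 _ sum≡-sum ⟩
  0ℤ ∎
  where
  open ≡-Reasoning
  vs = allVecs n n
  ι : Vec (Fin n) n → Vec (Fin n) n
  ι v = V.tabulate (Φ (V.lookup v))
  h : Vec (Fin n) n → ℤ
  h v = H (V.lookup v)
  ι-involutive : ∀ v → ι (ι v) ≡ v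
  ι-involutive v = trans
    (VP.tabulate-cong (λ i → trans (Φ-cong (VP.lookup∘tabulate (Φ (V.lookup v))) i) (Φ-involutive (V.lookup v) i)))
    (VP.tabulate∘lookup v)
  ι-injective : ∀ {v w} → ι v ≡ ι w → v ≡ w
  ι-injective {v} {w} ιv≡ιw = trans (sym (ι-involutive v)) (trans (cong ι ιv≡ιw) (ι-involutive w))
  map-ι↭ : map ι vs ↭ vs
  map-ι↭ = ∼bag⇒↭ (unique∧set⇒bag (UP.map⁺ ι-injective (allVecs-unique n n)) (allVecs-unique n n)
    (λ {v} → mk⇔ (λ _ → ∈-allVecs n n v)
                 (λ _ → subst (_∈ map ι vs) (ι-involutive v) (MemP.∈-map⁺ ι (∈-allVecs n n (ι v))))))
  sum≡-sum : sumℤ (map h vs) ≡ - sumℤ (map h vs)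
  sum≡-sum = begin
    sumℤ (map h vs)                ≡⟨ sumℤ-↭ (PermP.map⁺ h map-ι↭) ⟨
    sumℤ (map h (map ι vs))        ≡⟨ cong sumℤ (LP.map-∘ vs) ⟨
    sumℤ (map (h ∘ ι) vs)          ≡⟨ cong sumℤ (LP.map-cong (λ v → trans (H-cong (VP.lookup∘tabulate (Φ (V.lookup v))))
                                                                         (H∘Φ≡-H (V.lookup v))) vs) ⟩
    sumℤ (map (λ v → - h v) vs)    ≡⟨ sumℤ-map-neg h vs ⟩
    - sumℤ (map h vs)              ∎

prodℤ-indicator : ∀ {A : Set} (b : A → Bool) xs →
  prodℤ (map (λ x → if b x then 1ℤ else 0ℤ) xs) ≡ (if all b xs then 1ℤ else 0ℤ)
prodℤ-indicator b [] = refl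
prodℤ-indicator b (x ∷ xs) with b x
... | true = trans (ℤP.*-identityˡ (prodℤ (map (λ x → if b x then 1ℤ else 0ℤ) xs))) (prodℤ-indicator b xs)
... | false = ℤP.*-zeroˡ (prodℤ (map (λ x → if b x then 1ℤ else 0ℤ) xs))

det-indicator : ∀ {n} (A : Fin n → Fin n → Bool) →
  det (λ i j → if A i j then 1ℤ else 0ℤ) ≡
  sumℤ (map (λ π → sgn π * (if all (λ i → A i (π i)) (allFin n) then 1ℤ else 0ℤ)) (perms n))
det-indicator {n} A =
  cong sumℤ (LP.map-cong (λ π → cong (sgn π *_) (prodℤ-indicator (λ i → A i (π i)) (allFin n))) (perms n))

sgn≡1⊎sgn≡-1 : ∀ {n} (π : Fin n → Fin n) → sgn π ≡ 1ℤ ⊎ sgn π ≡ -1ℤ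
sgn≡1⊎sgn≡-1 π with evenᵇ (inversions π)
... | true = inj₁ refl
... | false = inj₂ refl

countSgn : ∀ {n} → ((Fin n → Fin n) → Bool) → ℤ → List (Fin n → Fin n) → ℕ
countSgn p s = count (λ π → p π ∧ ⌊ sgn π ℤ.≟ s ⌋)

sumℤ-sgn≡countSgn : ∀ {n} (p : (Fin n → Fin n) → Bool) πs →
  sumℤ (map (λ π → if p π then sgn π else 0ℤ) πs) ≡ + countSgn p 1ℤ πs - + countSgn p -1ℤ πs
sumℤ-sgn≡countSgn p [] = refl
sumℤ-sgn≡countSgn p (π ∷ πs)
  rewrite count-∷ (λ π → p π ∧ ⌊ sgn π ℤ.≟ 1ℤ ⌋) π πs | count-∷ (λ π → p π ∧ ⌊ sgn π ℤ.≟ -1ℤ ⌋) π πs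
  with p π | sgn≡1⊎sgn≡-1 π
... | false | _ = trans (ℤP.+-identityˡ _) (sumℤ-sgn≡countSgn p πs)
... | true | inj₁ sgn≡1 rewrite sgn≡1 =
  trans (cong (_+_ 1ℤ) (sumℤ-sgn≡countSgn p πs)) (shift (+ countSgn p 1ℤ πs) (+ countSgn p -1ℤ πs))
  where
  shift : ∀ a b → 1ℤ + (a - b) ≡ (1ℤ + a) - b
  shift = solve-∀
... | true | inj₂ sgn≡-1 rewrite sgn≡-1 =
  trans (cong (_+_ -1ℤ) (sumℤ-sgn≡countSgn p πs)) (shift (+ countSgn p 1ℤ πs) (+ countSgn p -1ℤ πs))
  where
  shift : ∀ a b → -1ℤ + (a - b) ≡ a - (1ℤ + b)
  shift = solve-∀

sumℤ-sgn-split : ∀ {n} (p q : (Fin n → Fin n) → Bool) →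
  sumℤ (map (λ π → if p π ∧ not (q π) then sgn π else 0ℤ) (perms n)) ≡ 0ℤ →
  sumℤ (map (λ π → sgn π * (if p π then 1ℤ else 0ℤ)) (perms n)) ≡
    + count (λ π → p π ∧ q π ∧ ⌊ sgn π ℤ.≟ 1ℤ ⌋) (perms n)
      - + count (λ π → p π ∧ q π ∧ ⌊ sgn π ℤ.≟ -1ℤ ⌋) (perms n)
sumℤ-sgn-split {n} p q rest≡0 = begin
  sumℤ (map (λ π → sgn π * (if p π then 1ℤ else 0ℤ)) (perms n))
    ≡⟨ cong sumℤ (LP.map-cong (λ π → split (sgn π) (p π) (q π)) (perms n)) ⟩
  sumℤ (map (λ π → (if p π ∧ q π then sgn π else 0ℤ) + (if p π ∧ not (q π) then sgn π else 0ℤ)) (perms n))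
    ≡⟨ sumℤ-map-+ _ _ (perms n) ⟩
  sumℤ (map (λ π → if p π ∧ q π then sgn π else 0ℤ) (perms n))
    + sumℤ (map (λ π → if p π ∧ not (q π) then sgn π else 0ℤ) (perms n))
    ≡⟨ cong₂ _+_ (sumℤ-sgn≡countSgn (λ π → p π ∧ q π) (perms n)) rest≡0 ⟩
  (+ countSgn (λ π → p π ∧ q π) 1ℤ (perms n) - + countSgn (λ π → p π ∧ q π) -1ℤ (perms n)) + 0ℤ
    ≡⟨ ℤP.+-identityʳ _ ⟩
  + countSgn (λ π → p π ∧ q π) 1ℤ (perms n) - + countSgn (λ π → p π ∧ q π) -1ℤ (perms n)
    ≡⟨ cong₂ (λ k l → + k - + l) (count-cong (λ π → BP.∧-assoc (p π) (q π) _) (perms n))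
                                 (count-cong (λ π → BP.∧-assoc (p π) (q π) _) (perms n)) ⟩
  + count (λ π → p π ∧ q π ∧ ⌊ sgn π ℤ.≟ 1ℤ ⌋) (perms n)
    - + count (λ π → p π ∧ q π ∧ ⌊ sgn π ℤ.≟ -1ℤ ⌋) (perms n) ∎
  where
  open ≡-Reasoning
  split : ∀ s a b → s * (if a then 1ℤ else 0ℤ) ≡ (if a ∧ b then s else 0ℤ) + (if a ∧ not b then s else 0ℤ)
  split s true true = trans (ℤP.*-identityʳ s) (sym (ℤP.+-identityʳ s))
  split s true false = trans (ℤP.*-identityʳ s) (sym (ℤP.+-identityˡ s))
  split s false _ = ℤP.*-zeroʳ s

-- The CFI graph

module _ {m k : ℕ} (adj : Fin m → Fin k → Bool) (cubic : CFI.Cubic adj)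
         {n : ℕ} (η : CFI.X adj ↔ Fin n) (η′ : CFI.Y adj ↔ Fin n) where
  open CFI adj

  toX : X → Fin n
  toX = Inverse.to η
  fromX : Fin n → X
  fromX = Inverse.from η
  toY : Y → Fin n
  toY = Inverse.to η′
  fromY : Fin n → Y
  fromY = Inverse.from η′

  toX-injective : ∀ {x x′} → toX x ≡ toX x′ → x ≡ x′
  toX-injective {x} {x′} eq =
    trans (sym (Inverse.strictlyInverseʳ η x)) (trans (cong fromX eq) (Inverse.strictlyInverseʳ η x′))

  toY-injective : ∀ {y y′} → toY y ≡ toY y′ → y ≡ y′
  toY-injective {y} {y′} eq =
    trans (sym (Inverse.strictlyInverseʳ η′ y)) (trans (cong fromY eq) (Inverse.strictlyInverseʳ η′ y′))

  isMatching : (Fin n → Fin n) → Bool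
  isMatching = isMatchingᵇ η η′

  isUniform : (Fin n → Fin n) → Bool
  isUniform = uniformᵇ η η′

  isMatching-cong : ∀ {π ρ} → π ≗ ρ → isMatching π ≡ isMatching ρ
  isMatching-cong π≗ρ = all-cong (λ i → cong (adjXY (fromX i) ∘ fromY) (π≗ρ i)) (allFin n)

  isMatching⇒adjacent : ∀ {π} → isMatching π ≡ true → ∀ x → adjXY x (fromY (π (toX x))) ≡ true
  isMatching⇒adjacent {π} match x = subst (λ x′ → adjXY x′ (fromY (π (toX x))) ≡ true) (Inverse.strictlyInverseʳ η x)
    (all-lookup _ match (MemP.∈-allFin (toX x)))

  adjacent⇒isMatching : ∀ {π} → (∀ x → adjXY x (fromY (π (toX x))) ≡ true) → isMatching π ≡ true
  adjacent⇒isMatching {π} adjacent = all-tabulate _ (allFin n) (λ i →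
    subst (λ j → adjXY (fromX i) (fromY (π j)) ≡ true) (Inverse.strictlyInverseˡ η i) (adjacent (fromX i)))

  Edge : Set
  Edge = Σ (Fin m) λ u → Σ (Fin k) λ v → T (adj u v)

  usesBoth : (Fin n → Fin n) → (u : Fin m) (v : Fin k) → T (adj u v) → Bool
  usesBoth π u v e = (π (toX (outX v u e false)) ==F toY (outY u v e false))
                   ∧ (π (toX (outX v u e true)) ==F toY (outY u v e true))

  doubledEdge : (Fin n → Fin n) → Maybe Edge
  doubledEdge π = firstJust (λ u → firstJust (λ v → whenT (adj u v) (λ e →
    if usesBoth π u v e then just (u , v , e) else nothing)) (allFin k)) (allFin m)

  isUniform≡no-doubledEdge : ∀ π → isUniform π ≡ is-nothing (doubledEdge π)
  isUniform≡no-doubledEdge π = trans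
    (all-cong (λ u → trans (all-cong (λ v → guard-not≡is-nothing (adj u v) (usesBoth π u v) (λ e → u , v , e)) (allFin k))
                           (all-is-nothing≡is-nothing-firstJust _ (allFin k))) (allFin m))
    (all-is-nothing≡is-nothing-firstJust _ (allFin m))

  doubledEdge⇒usesBoth : ∀ π {u v e} → doubledEdge π ≡ just (u , v , e) → usesBoth π u v e ≡ true
  doubledEdge⇒usesBoth π found
    with u , found-u ← firstJust≡just _ (allFin m) found
    with v , found-v ← firstJust≡just _ (allFin k) found-u
    with e , found-e ← whenT≡just (adj u v) found-v
    with usesBoth π u v e in doubled | found-e
  ... | true | refl = doubled

  doubledEdge-determined : ∀ {π ρ} → (∀ u v e → usesBoth π u v e ≡ usesBoth ρ u v e) →
    doubledEdge π ≡ doubledEdge ρ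
  doubledEdge-determined same = firstJust-cong (λ u → firstJust-cong (λ v → whenT-cong (adj u v)
    (λ e → cong (if_then just (u , v , e) else nothing) (same u v e))) (allFin k)) (allFin m)

  usesBoth-determined : ∀ {π ρ} → (∀ v u e β → π (toX (outX v u e β)) ≡ ρ (toX (outX v u e β))) →
    ∀ u v e → usesBoth π u v e ≡ usesBoth ρ u v e
  usesBoth-determined agree u v e = cong₂ (λ p q → (p ==F toY (outY u v e false)) ∧ (q ==F toY (outY u v e true)))
    (agree v u e false) (agree v u e true)

  doubledEdge-cong : ∀ {π ρ} → π ≗ ρ → doubledEdge π ≡ doubledEdge ρ
  doubledEdge-cong {π} {ρ} π≗ρ = doubledEdge-determined {π} {ρ} (usesBoth-determined {π} {ρ} (λ _ _ _ _ → π≗ρ _))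

  record OtherNeighbours (u : Fin m) (v : Fin k) : Set where
    field
      w₀ w₁ : Fin k
      adj-w₀ : T (adj u w₀)
      adj-w₁ : T (adj u w₁)
      w₀≢v : ¬ w₀ ≡ v
      w₁≢v : ¬ w₁ ≡ v
      w₀≢w₁ : ¬ w₀ ≡ w₁
      neighbour : ∀ {x} → T (adj u x) → x ≡ v ⊎ x ≡ w₀ ⊎ x ≡ w₁

  swapOthers : ∀ {u v} → OtherNeighbours u v → OtherNeighbours u v
  swapOthers N = record
    { w₀ = w₁ ; w₁ = w₀ ; adj-w₀ = adj-w₁ ; adj-w₁ = adj-w₀ ; w₀≢v = w₁≢v ; w₁≢v = w₀≢v
    ; w₀≢w₁ = w₀≢w₁ ∘ sym ; neighbour = Sum.map₂ Sum.swap ∘ neighbour }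
    where open OtherNeighbours N

  others : Fin m → Fin k → List (Fin k)
  others u v = filterᵇ (λ x → adj u x ∧ not (x ==F v)) (allFin k)

  length-others : ∀ u v → T (adj u v) → length (others u v) ≡ 2
  length-others u v e = sym (ℕP.suc-injective (begin
    3                                                   ≡⟨ proj₁ cubic u ⟨
    ∣ NU u ∣                                            ≡⟨ card-tabulate (adj u) ⟩
    count (adj u) (allFin k)                            ≡⟨ count-split (adj u) (_==F v) (allFin k) ⟩
    count (λ x → adj u x ∧ (x ==F v)) (allFin k) ℕ.+ length (others u v)
      ≡⟨ cong (ℕ._+ length (others u v)) (trans (count-cong adj∧≡v (allFin k)) (count-==F k v)) ⟩
    1 ℕ.+ length (others u v)                           ∎))
    where
    open ≡-Reasoning
    adj∧≡v : ∀ x → (adj u x ∧ (x ==F v)) ≡ (x ==F v)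
    adj∧≡v x with x F.≟ v
    ... | yes refl = cong (_∧ true) (T⇒≡true e)
    ... | no _ = BP.∧-zeroʳ (adj u x)

  otherNeighbours : ∀ u v → T (adj u v) → OtherNeighbours u v
  otherNeighbours u v e = fromPair (others u v) refl (length-others u v e)
    where
    isOther : Fin k → Bool
    isOther x = adj u x ∧ not (x ==F v)
    other : ∀ {x} → x ∈ others u v → T (adj u x) × ¬ x ≡ v
    other x∈ = let isOther-x = Equivalence.to BP.T-∧ (proj₂ (MemP.∈-filter⁻ (T? ∘ isOther) {xs = allFin k} x∈)) in
      proj₁ isOther-x , λ {refl → subst T (cong not (==F-refl v)) (proj₂ isOther-x)}
    fromPair : ∀ xs → others u v ≡ xs → length xs ≡ 2 → OtherNeighbours u v
    fromPair (w₀ ∷ w₁ ∷ []) others≡ _ = record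
      { w₀ = w₀ ; w₁ = w₁ ; adj-w₀ = proj₁ other-w₀ ; adj-w₁ = proj₁ other-w₁
      ; w₀≢v = proj₂ other-w₀ ; w₁≢v = proj₂ other-w₁ ; w₀≢w₁ = w₀≢w₁ ; neighbour = neighbour }
      where
      other-w₀ = other (subst (w₀ ∈_) (sym others≡) (here refl))
      other-w₁ = other (subst (w₁ ∈_) (sym others≡) (there (here refl)))
      w₀≢w₁ : ¬ w₀ ≡ w₁
      w₀≢w₁ with subst Unique others≡ (UP.filter⁺ (T? ∘ isOther) (UP.allFin⁺ k))
      ... | (w₀≢w₁ All.∷ _) ∷ _ = w₀≢w₁
      neighbour : ∀ {x} → T (adj u x) → x ≡ v ⊎ x ≡ w₀ ⊎ x ≡ w₁
      neighbour {x} adj-x with x F.≟ v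
      ... | yes x≡v = inj₁ x≡v
      ... | no x≢v with subst (x ∈_) others≡ (MemP.∈-filter⁺ (T? ∘ isOther) (MemP.∈-allFin x)
                          (Equivalence.from BP.T-∧ (adj-x , subst T (cong not (sym (≢⇒==F≡false x≢v))) _)))
      ...   | here x≡w₀ = inj₂ (inj₁ x≡w₀)
      ...   | there (here x≡w₁) = inj₂ (inj₂ x≡w₁)

  inX-injective : ∀ {u S S′ p p′} → inX u S p ≡ inX u S′ p′ → S ≡ S′
  inX-injective refl = refl

  inner : (u : Fin m) (f : Fin k → Bool) → (∀ x → f x ≡ true → adj u x ≡ true) →
    evenᵇ (count f (allFin k)) ≡ true → X
  inner u f f⊆adj even = inX u (V.tabulate f)
    (≡true⇒T (cong₂ _∧_ (⊆ᵇ-tabulate f (adj u) f⊆adj) (trans (cong evenᵇ (card-tabulate f)) even)))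

  emptyInner : Fin m → X
  emptyInner u = inner u (λ _ → false) (λ _ ()) (cong evenᵇ (count-false _ (λ _ → refl) (allFin k)))

  pairInner : (u : Fin m) (p q : Fin k) → T (adj u p) → T (adj u q) → ¬ p ≡ q → X
  pairInner u p q adj-p adj-q p≢q = inner u (pairSet p q) pair⊆adj
    (cong evenᵇ (trans (count-∨-disjoint (_==F p) (_==F q) disjoint (allFin k))
                       (cong₂ ℕ._+_ (count-==F k p) (count-==F k q))))
    where
    pair⊆adj : ∀ x → pairSet p q x ≡ true → adj u x ≡ true
    pair⊆adj x x∈ with x F.≟ p
    ... | yes refl = T⇒≡true adj-p
    ... | no _ rewrite ==F⇒≡ {i = x} {j = q} x∈ = T⇒≡true adj-q
    disjoint : ∀ x → (x ==F p) ≡ true → (x ==F q) ≡ false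
    disjoint x x==p rewrite ==F⇒≡ {i = x} {j = p} x==p = ≢⇒==F≡false p≢q

  module _ {u : Fin m} {v : Fin k} (N : OtherNeighbours u v) where
    open OtherNeighbours N

    y₀ y₁ : Bool → Fin n
    y₀ β = toY (outY u w₀ adj-w₀ β)
    y₁ β = toY (outY u w₁ adj-w₁ β)

    rotation : Fin n → Fin n
    rotation = cycle4 (y₀ false) (y₁ false) (y₀ true) (y₁ true)

  -- Which of the two perfect matchings of the 8-cycle π uses is read off from the partner of u_∅.
  rotate : Edge → (Fin n → Fin n) → Fin n → Fin n
  rotate (u , v , e) π i =
    if π (toX (emptyInner u)) ==F y₀ N false then rotation N (π i) else rotation (swapOthers N) (π i)
    where N = otherNeighbours u v e

  record Rotated (π ρ : Fin n → Fin n) : Set where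
    field
      bijective : isBijᵇ ρ ≡ true
      matching : isMatching ρ ≡ true
      doubledEdge-preserved : doubledEdge ρ ≡ doubledEdge π
      sgn-negated : sgn ρ ≡ - sgn π

  module DoubledEdge {π : Fin n → Fin n} {u : Fin m} {v : Fin k} {e : T (adj u v)} (N : OtherNeighbours u v)
                     (π-bij : isBijᵇ π ≡ true) (π-match : isMatching π ≡ true) (π-doubled : usesBoth π u v e ≡ true) where
    open OtherNeighbours N

    π-inj : Injective _≡_ _≡_ π
    π-inj = proj₁ (isBijᵇ-sound π-bij)

    π-surj : StrictlySurjective _≡_ π
    π-surj = proj₂ (isBijᵇ-sound π-bij)

    π-outer : ∀ β → π (toX (outX v u e β)) ≡ toY (outY u v e β)
    π-outer false = ==F⇒≡ (proj₁ (∧≡true-split π-doubled))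
    π-outer true = ==F⇒≡ (proj₂ (∧≡true-split π-doubled))

    inner-neighbour : ∀ S p (y : Y) → adjXY (inX u S p) y ≡ true → (∀ β → ¬ y ≡ outY u v e β) →
      y ≡ outY u w₀ adj-w₀ (V.lookup S w₀) ⊎ y ≡ outY u w₁ adj-w₁ (V.lookup S w₁)
    inner-neighbour S p (outY u′ x adj-x β) adjacent not-v
      with refl ← ==F⇒≡ (proj₁ (∧≡true-split {u ==F u′} adjacent))
      with refl ← ==B⇒≡ {β} (proj₂ (∧≡true-split {u ==F u′} adjacent))
      with neighbour adj-x
    ... | inj₁ refl = ⊥-elim (not-v (V.lookup S x) (cong (λ t → outY u x t _) (BP.T-irrelevant adj-x e)))
    ... | inj₂ (inj₁ refl) = inj₁ (cong (λ t → outY u x t _) (BP.T-irrelevant adj-x adj-w₀))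
    ... | inj₂ (inj₂ refl) = inj₂ (cong (λ t → outY u x t _) (BP.T-irrelevant adj-x adj-w₁))

    inner-image : ∀ f f⊆adj even → let I = inner u f f⊆adj even in
      π (toX I) ≡ y₀ N (f w₀) ⊎ π (toX I) ≡ y₁ N (f w₁)
    inner-image f f⊆adj even with inner-neighbour (V.tabulate f) _ (fromY (π (toX I))) (isMatching⇒adjacent π-match I) not-v
      where
      I = inner u f f⊆adj even
      not-v : ∀ β → ¬ fromY (π (toX I)) ≡ outY u v e β
      not-v β eq with () ← toX-injective (π-inj (trans (sym (Inverse.strictlyInverseˡ η′ _))
                                              (trans (cong toY eq) (sym (π-outer β)))))
    ... | inj₁ eq = inj₁ (trans (sym (Inverse.strictlyInverseˡ η′ _)) (trans (cong toY eq)
                                 (cong (toY ∘ outY u w₀ adj-w₀) (VP.lookup∘tabulate f w₀))))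
    ... | inj₂ eq = inj₂ (trans (sym (Inverse.strictlyInverseˡ η′ _)) (trans (cong toY eq)
                                 (cong (toY ∘ outY u w₁ adj-w₁) (VP.lookup∘tabulate f w₁))))

    inner-images-differ : ∀ {f f⊆adj even g g⊆adj even′} z → ¬ f z ≡ g z →
      ¬ π (toX (inner u f f⊆adj even)) ≡ π (toX (inner u g g⊆adj even′))
    inner-images-differ {f} {g = g} z fz≢gz eq = fz≢gz (begin
      f z                          ≡⟨ VP.lookup∘tabulate f z ⟨
      V.lookup (V.tabulate f) z    ≡⟨ cong (λ S → V.lookup S z) (inX-injective (toX-injective (π-inj eq))) ⟩
      V.lookup (V.tabulate g) z    ≡⟨ VP.lookup∘tabulate g z ⟩
      g z                          ∎)
      where open ≡-Reasoning

  module Rotation {π : Fin n → Fin n} {u : Fin m} {v : Fin k} {e : T (adj u v)} (N : OtherNeighbours u v)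
                  (π-bij : isBijᵇ π ≡ true) (π-match : isMatching π ≡ true) (π-doubled : usesBoth π u v e ≡ true)
                  (π-empty : π (toX (emptyInner u)) ≡ y₀ N false) where
    open OtherNeighbours N
    open DoubledEdge N π-bij π-match π-doubled

    I∅ Iv₀ I₀₁ Iv₁ : X
    I∅ = emptyInner u
    Iv₀ = pairInner u v w₀ e adj-w₀ (w₀≢v ∘ sym)
    I₀₁ = pairInner u w₀ w₁ adj-w₀ adj-w₁ w₀≢w₁
    Iv₁ = pairInner u v w₁ e adj-w₁ (w₁≢v ∘ sym)

    -- Injectivity forces the partners of the other three inner vertices of u one after another.
    π-Iv₁ : π (toX Iv₁) ≡ y₁ N true
    π-Iv₁ with inner-image (pairSet v w₁) _ _
    ... | inj₁ eq = ⊥-elim (inner-images-differ v (BP.not-¬ (pairSet-ˡ v w₁))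
                      (trans eq (trans (cong (y₀ N) (pairSet-∉ w₀≢v w₀≢w₁)) (sym π-empty))))
    ... | inj₂ eq = trans eq (cong (y₁ N) (pairSet-ʳ v w₁))

    π-I₀₁ : π (toX I₀₁) ≡ y₀ N true
    π-I₀₁ with inner-image (pairSet w₀ w₁) _ _
    ... | inj₁ eq = trans eq (cong (y₀ N) (pairSet-ˡ w₀ w₁))
    ... | inj₂ eq = ⊥-elim (inner-images-differ w₀ (BP.not-¬ (pairSet-ˡ w₀ w₁) ∘ flip trans (pairSet-∉ w₀≢v w₀≢w₁))
                      (trans eq (trans (cong (y₁ N) (pairSet-ʳ w₀ w₁)) (sym π-Iv₁))))

    π-Iv₀ : π (toX Iv₀) ≡ y₁ N false
    π-Iv₀ with inner-image (pairSet v w₀) _ _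
    ... | inj₁ eq = ⊥-elim (inner-images-differ w₁
                      (λ differ → BP.not-¬ (pairSet-ʳ w₀ w₁) (trans (sym differ) (pairSet-∉ w₁≢v (w₀≢w₁ ∘ sym))))
                      (trans eq (trans (cong (y₀ N) (pairSet-ʳ v w₀)) (sym π-I₀₁))))
    ... | inj₂ eq = trans eq (cong (y₁ N) (pairSet-∉ w₁≢v (w₀≢w₁ ∘ sym)))

    distinct : Distinct4 (y₀ N false) (y₁ N false) (y₀ N true) (y₁ N true)
    distinct = record
      { p≢q = w₀≢w₁ ∘ positions-differ ; p≢r = (λ ()) ∘ values-differ ; p≢s = w₀≢w₁ ∘ positions-differ
      ; q≢r = w₀≢w₁ ∘ sym ∘ positions-differ ; q≢s = (λ ()) ∘ values-differ ; r≢s = w₀≢w₁ ∘ positions-differ }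
      where
      positions-differ : ∀ {x x′ t t′ β β′} → toY (outY u x t β) ≡ toY (outY u x′ t′ β′) → x ≡ x′
      positions-differ eq with refl ← toY-injective eq = refl
      values-differ : ∀ {x t β β′} → toY (outY u x t β) ≡ toY (outY u x t β′) → β ≡ β′
      values-differ eq with refl ← toY-injective eq = refl

    inner-adjacent : ∀ {f f⊆adj even w} (adj-w : T (adj u w)) {β} → f w ≡ β →
      adjXY (inner u f f⊆adj even) (fromY (toY (outY u w adj-w β))) ≡ true
    inner-adjacent {f} {w = w} adj-w {β} fw≡β
      rewrite Inverse.strictlyInverseʳ η′ (outY u w adj-w β) | ==F-refl u | VP.lookup∘tabulate f w | fw≡β
      = ==B-refl β

    rotated-adjacent : ∀ x → adjXY x (fromY (rotation N (π (toX x)))) ≡ true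
    rotated-adjacent x = by-cases (π (toX x) F.≟ y₀ N false) (π (toX x) F.≟ y₁ N false)
                                  (π (toX x) F.≟ y₀ N true) (π (toX x) F.≟ y₁ N true)
      where
      moved : ∀ {I y y′} → π (toX I) ≡ y → rotation N y ≡ y′ → adjXY I (fromY y′) ≡ true →
              π (toX x) ≡ y → adjXY x (fromY (rotation N (π (toX x)))) ≡ true
      moved {I} πI≡y rot-y adjacent πx≡y with refl ← toX-injective (π-inj (trans πx≡y (sym πI≡y)))
        rewrite πx≡y | rot-y = adjacent
      by-cases : Dec (π (toX x) ≡ y₀ N false) → Dec (π (toX x) ≡ y₁ N false) →
                 Dec (π (toX x) ≡ y₀ N true) → Dec (π (toX x) ≡ y₁ N true) →
                 adjXY x (fromY (rotation N (π (toX x)))) ≡ true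
      by-cases (yes eq) _ _ _ = moved π-empty (cycle4-p distinct) (inner-adjacent adj-w₁ refl) eq
      by-cases _ (yes eq) _ _ = moved π-Iv₀ (cycle4-q distinct) (inner-adjacent adj-w₀ (pairSet-ʳ v w₀)) eq
      by-cases _ _ (yes eq) _ = moved π-I₀₁ (cycle4-r distinct) (inner-adjacent adj-w₁ (pairSet-ʳ w₀ w₁)) eq
      by-cases _ _ _ (yes eq) = moved π-Iv₁ (cycle4-s distinct) (inner-adjacent adj-w₀ (pairSet-∉ w₀≢v w₀≢w₁)) eq
      by-cases (no ≢a) (no ≢b) (no ≢c) (no ≢d)
        rewrite cycle4-fix distinct ≢a ≢b ≢c ≢d = isMatching⇒adjacent π-match x

    outer-fixed : ∀ v′ u′ e′ β → rotation N (π (toX (outX v′ u′ e′ β))) ≡ π (toX (outX v′ u′ e′ β))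
    outer-fixed v′ u′ e′ β =
      cycle4-fix distinct (not-inner π-empty) (not-inner π-Iv₀) (not-inner π-I₀₁) (not-inner π-Iv₁)
      where
      not-inner : ∀ {S p y} → π (toX (inX u S p)) ≡ y → ¬ π (toX (outX v′ u′ e′ β)) ≡ y
      not-inner πI≡y eq with () ← toX-injective (π-inj (trans eq (sym πI≡y)))

    rotated : Rotated π (rotation N ∘ π)
    rotated = record
      { bijective = isBijᵇ-complete (cycle4-injective distinct π-inj) (cycle4-surjective distinct π-surj)
      ; matching = adjacent⇒isMatching rotated-adjacent
      ; doubledEdge-preserved =
          doubledEdge-determined {rotation N ∘ π} {π} (usesBoth-determined {rotation N ∘ π} {π} outer-fixed)
      ; sgn-negated = sgn-cycle4 distinct π-inj π-surj
      }

    rotated-empty : rotation N (π (toX I∅)) ≡ y₁ N false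
    rotated-empty = trans (cong (rotation N) π-empty) (cycle4-p distinct)

  Rotated-cong : ∀ {π ρ ρ′} → ρ ≗ ρ′ → Rotated π ρ → Rotated π ρ′
  Rotated-cong {π} {ρ} {ρ′} ρ≗ρ′ R = record
    { bijective = trans (isBijᵇ-cong (sym ∘ ρ≗ρ′)) bijective
    ; matching = trans (isMatching-cong (sym ∘ ρ≗ρ′)) matching
    ; doubledEdge-preserved = trans (doubledEdge-cong (sym ∘ ρ≗ρ′)) doubledEdge-preserved
    ; sgn-negated = trans (sgn-cong (sym ∘ ρ≗ρ′)) sgn-negated
    }
    where open Rotated R

  rotate-doubled : ∀ {π edge} → isBijᵇ π ≡ true → isMatching π ≡ true → doubledEdge π ≡ just edge →
    Rotated π (rotate edge π) × rotate edge (rotate edge π) ≗ π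
  rotate-doubled {π} {u , v , e} bij match found =
    by-case (DoubledEdge.inner-image N bij match doubled (λ _ → false) _ _)
    where
    doubled = doubledEdge⇒usesBoth π found
    N = otherNeighbours u v e
    ρ = rotate (u , v , e) π
    by-case : π (toX (emptyInner u)) ≡ y₀ N false ⊎ π (toX (emptyInner u)) ≡ y₁ N false →
      Rotated π ρ × rotate (u , v , e) ρ ≗ π
    by-case (inj₁ π∅≡y₀) = Rotated-cong (sym ∘ ρ≗) rotated , back
      where
      open Rotation N bij match doubled π∅≡y₀
      ρ≗ : ρ ≗ rotation N ∘ π
      ρ≗ i = cong (if_then rotation N (π i) else rotation (swapOthers N) (π i))
                  (trans (cong (_==F y₀ N false) π∅≡y₀) (==F-refl (y₀ N false)))
      back : rotate (u , v , e) ρ ≗ π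
      back i = begin
        rotate (u , v , e) ρ i
          ≡⟨ cong (if_then rotation N (ρ i) else rotation (swapOthers N) (ρ i))
               (trans (cong (_==F y₀ N false) (trans (ρ≗ (toX I∅)) rotated-empty))
                      (≢⇒==F≡false (Distinct4.p≢q distinct ∘ sym))) ⟩
        rotation (swapOthers N) (ρ i)        ≡⟨ cong (rotation (swapOthers N)) (ρ≗ i) ⟩
        rotation (swapOthers N) (rotation N (π i)) ≡⟨ cycle4-reverse-inverse distinct (π i) ⟩
        π i ∎
        where open ≡-Reasoning
    by-case (inj₂ π∅≡y₁) = Rotated-cong (sym ∘ ρ≗) rotated , back
      where
      open Rotation (swapOthers N) bij match doubled π∅≡y₁
      ρ≗ : ρ ≗ rotation (swapOthers N) ∘ π
      ρ≗ i = cong (if_then rotation N (π i) else rotation (swapOthers N) (π i))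
                  (trans (cong (_==F y₀ N false) π∅≡y₁) (≢⇒==F≡false (Distinct4.p≢q distinct)))
      back : rotate (u , v , e) ρ ≗ π
      back i = begin
        rotate (u , v , e) ρ i
          ≡⟨ cong (if_then rotation N (ρ i) else rotation (swapOthers N) (ρ i))
               (trans (cong (_==F y₀ N false) (trans (ρ≗ (toX I∅)) rotated-empty)) (==F-refl (y₀ N false))) ⟩
        rotation N (ρ i)                     ≡⟨ cong (rotation N) (ρ≗ i) ⟩
        rotation N (rotation (swapOthers N) (π i)) ≡⟨ cycle4-reverse-inverse distinct (π i) ⟩
        π i ∎
        where open ≡-Reasoning

  rotateIf : Bool → Maybe Edge → (Fin n → Fin n) → Fin n → Fin n
  rotateIf true (just edge) π = rotate edge π
  rotateIf true nothing π = π
  rotateIf false _ π = π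

  rotateDoubled : (Fin n → Fin n) → Fin n → Fin n
  rotateDoubled π = rotateIf (isBijᵇ π ∧ isMatching π) (doubledEdge π) π

  nonUniformSgn : (Fin n → Fin n) → ℤ
  nonUniformSgn π = if isBijᵇ π then (if isMatching π ∧ not (isUniform π) then sgn π else 0ℤ) else 0ℤ

  rotateDoubled-cong : ∀ {π ρ} → π ≗ ρ → rotateDoubled π ≗ rotateDoubled ρ
  rotateDoubled-cong {π} {ρ} π≗ρ i =
    trans (cong₂ (λ b edge → rotateIf b edge π i)
                 (cong₂ _∧_ (isBijᵇ-cong π≗ρ) (isMatching-cong π≗ρ)) (doubledEdge-cong π≗ρ))
          (rotateIf-cong (isBijᵇ ρ ∧ isMatching ρ) (doubledEdge ρ))
    where
    rotateIf-cong : ∀ b edge → rotateIf b edge π i ≡ rotateIf b edge ρ i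
    rotateIf-cong true (just (u , v , e)) =
      cong₂ (λ π∅ πi → if π∅ ==F y₀ (otherNeighbours u v e) false then rotation (otherNeighbours u v e) πi
                         else rotation (swapOthers (otherNeighbours u v e)) πi) (π≗ρ _) (π≗ρ i)
    rotateIf-cong true nothing = π≗ρ i
    rotateIf-cong false _ = π≗ρ i

  nonUniformSgn-cong : ∀ {π ρ} → π ≗ ρ → nonUniformSgn π ≡ nonUniformSgn ρ
  nonUniformSgn-cong {π} {ρ} π≗ρ =
    cong₂ (λ bij rest → if bij then rest else 0ℤ) (isBijᵇ-cong π≗ρ)
      (cong₂ (λ valid s → if valid then s else 0ℤ)
        (cong₂ (λ match uniform → match ∧ not uniform) (isMatching-cong π≗ρ)
          (trans (isUniform≡no-doubledEdge π)
            (trans (cong is-nothing (doubledEdge-cong π≗ρ)) (sym (isUniform≡no-doubledEdge ρ)))))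
        (sgn-cong π≗ρ))

  rotateDoubled-at : ∀ {π edge} → isBijᵇ π ≡ true → isMatching π ≡ true → doubledEdge π ≡ just edge →
    rotateDoubled π ≡ rotate edge π
  rotateDoubled-at {π} bij match found =
    trans (cong₂ (λ b c → rotateIf (b ∧ c) (doubledEdge π) π) bij match) (cong (λ edge → rotateIf true edge π) found)

  nonUniformSgn-doubled : ∀ {π edge} → isBijᵇ π ≡ true → isMatching π ≡ true → doubledEdge π ≡ just edge →
    nonUniformSgn π ≡ sgn π
  nonUniformSgn-doubled {π} bij match found =
    trans (cong₂ (λ b c → if b then (if c ∧ not (isUniform π) then sgn π else 0ℤ) else 0ℤ) bij match)
          (cong (λ uniform → if not uniform then sgn π else 0ℤ)
                (trans (isUniform≡no-doubledEdge π) (cong is-nothing found)))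

  data Behaviour (π : Fin n → Fin n) : Set where
    fixes : rotateDoubled π ≗ π → nonUniformSgn π ≡ 0ℤ → Behaviour π
    rotates : ∀ {edge} → isBijᵇ π ≡ true → isMatching π ≡ true → doubledEdge π ≡ just edge →
              rotateDoubled π ≡ rotate edge π → Behaviour π

  behaviour : ∀ π → Behaviour π
  behaviour π with isBijᵇ π in bij | isMatching π in match | doubledEdge π in found
  ... | false | _ | _ =
    fixes (λ i → cong (λ b → rotateIf (b ∧ isMatching π) (doubledEdge π) π i) bij)
          (cong (λ b → if b then (if isMatching π ∧ not (isUniform π) then sgn π else 0ℤ) else 0ℤ) bij)
  ... | true | false | _ =
    fixes (λ i → cong₂ (λ b c → rotateIf (b ∧ c) (doubledEdge π) π i) bij match)
          (cong₂ (λ b c → if b then (if c ∧ not (isUniform π) then sgn π else 0ℤ) else 0ℤ) bij match)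
  ... | true | true | nothing =
    fixes (λ i → trans (cong₂ (λ b c → rotateIf (b ∧ c) (doubledEdge π) π i) bij match)
                       (cong (λ edge → rotateIf true edge π i) found))
          (trans (cong₂ (λ b c → if b then (if c ∧ not (isUniform π) then sgn π else 0ℤ) else 0ℤ) bij match)
                 (cong (λ uniform → if not uniform then sgn π else 0ℤ)
                       (trans (isUniform≡no-doubledEdge π) (cong is-nothing found))))
  ... | true | true | just edge = rotates bij match found (rotateDoubled-at bij match found)

  nonUniformSgn-rotateDoubled : ∀ π → nonUniformSgn (rotateDoubled π) ≡ - nonUniformSgn π
  nonUniformSgn-rotateDoubled π with behaviour π
  ... | fixes fixed vanishes = trans (nonUniformSgn-cong fixed) (trans vanishes (cong -_ (sym vanishes)))
  ... | rotates {edge} bij match found rotateDoubled≡ = begin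
    nonUniformSgn (rotateDoubled π)  ≡⟨ cong nonUniformSgn rotateDoubled≡ ⟩
    nonUniformSgn (rotate edge π)    ≡⟨ nonUniformSgn-doubled bijective matching (trans doubledEdge-preserved found) ⟩
    sgn (rotate edge π)              ≡⟨ sgn-negated ⟩
    - sgn π                          ≡⟨ cong -_ (nonUniformSgn-doubled bij match found) ⟨
    - nonUniformSgn π                ∎
    where
    open ≡-Reasoning
    open Rotated (proj₁ (rotate-doubled bij match found))

  rotateDoubled-involutive : ∀ π → rotateDoubled (rotateDoubled π) ≗ π
  rotateDoubled-involutive π with behaviour π
  ... | fixes fixed _ = λ i → trans (rotateDoubled-cong fixed i) (fixed i)
  ... | rotates {edge} bij match found rotateDoubled≡ = λ i → begin
    rotateDoubled (rotateDoubled π) i    ≡⟨ cong (λ ρ → rotateDoubled ρ i) rotateDoubled≡ ⟩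
    rotateDoubled (rotate edge π) i
      ≡⟨ cong (_$ i) (rotateDoubled-at bijective matching (trans doubledEdge-preserved found)) ⟩
    rotate edge (rotate edge π) i        ≡⟨ proj₂ (rotate-doubled bij match found) i ⟩
    π i                                  ∎
    where
    open ≡-Reasoning
    open Rotated (proj₁ (rotate-doubled bij match found))

  nonUniform-sum≡0 : sumℤ (map (λ π → if isMatching π ∧ not (isUniform π) then sgn π else 0ℤ) (perms n)) ≡ 0ℤ
  nonUniform-sum≡0 = trans (sumℤ-map-filterᵇ _ isBijᵇ (funs n n))
    (sumℤ-funs-signReversingInvolution nonUniformSgn rotateDoubled
      nonUniformSgn-cong rotateDoubled-cong rotateDoubled-involutive nonUniformSgn-rotateDoubled)

mainTheorem2 : (m k : ℕ) (adj : Fin m → Fin k → Bool) → CFI.Cubic adj →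
    (n : ℕ) (η : CFI.X adj ↔ Fin n) (η′ : CFI.Y adj ↔ Fin n) →
    det (CFI.M adj η η′) ≡ + CFI.#UMatchSgn adj η η′ 1ℤ - + CFI.#UMatchSgn adj η η′ -1ℤ
mainTheorem2 m k adj cubic n η η′ = begin
  det (CFI.M adj η η′)
    ≡⟨ det-indicator (λ i j → CFI.adjXY adj (Inverse.from η i) (Inverse.from η′ j)) ⟩
  sumℤ (map (λ π → sgn π * (if isMatching adj cubic η η′ π then 1ℤ else 0ℤ)) (perms n))
    ≡⟨ sumℤ-sgn-split (isMatching adj cubic η η′) (isUniform adj cubic η η′) (nonUniform-sum≡0 adj cubic η η′) ⟩
  + CFI.#UMatchSgn adj η η′ 1ℤ - + CFI.#UMatchSgn adj η η′ -1ℤ ∎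
  where open ≡-Reasoning
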